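{- For integers $a\ge 2$, $b\ge 1$ and $n=1+ab$, $$\mathrm{Mo}^{*}(S_{a,b})=\frac{(n-1)\left(3abn-5ab^2-3an+3ab+2a+2b^2-9b+6n-5\right)}{6}.$$
   Context: $S_{a,b}$ denotes the balanced spider of order $ab+1$: a central vertex $c$ together with $a$ vertex-disjoint paths (legs) on $b$ vertices each, each leg joined to $c$ by an edge from one of its endpoints. For a graph $G$ and distinct vertices $u,v$, let $n_G(u,v)$ be the number of vertices strictly closer to $u$ than to $v$. The total Mostar index is $\mathrm{Mo}^{*}(G)=\sum_{\{u,v\}\subset V(G),\,u\neq v}|n_G(u,v)-n_G(v,u)|$. -}

module Defs where

open import Data.Nat using (ℕ; zero; suc; _+_; _*_; _∸_; _<ᵇ_; _≡ᵇ_; ∣_-_∣)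
open import Data.Nat.DivMod using (_/_; _%_)
open import Data.Bool using (Bool; true; false; _∧_; _∨_; not; if_then_else_)
open import Data.Fin using (Fin; toℕ; _≟_)
open import Data.List using (List; map; allFin; upTo)
open import Data.Nat.ListAction using (sum)
open import Data.Bool.ListAction using (any)
open import Relation.Nullary.Decidable using (isYes)

record Graph : Set where
  field
    N   : ℕ
    adj : Fin N → Fin N → Bool
open Graph public

ball : (G : Graph) → Fin (N G) → ℕ → Fin (N G) → Bool
ball G u zero    w = isYes (w ≟ u)
ball G u (suc k) w = ball G u k w ∨ any (λ x → ball G u k x ∧ adj G x w) (allFin (N G))

-- For a connected graph this is exactly
-- the least k with v in ball u k, i.e. the usual graph distance d(u,v).
dist : (G : Graph) → Fin (N G) → Fin (N G) → ℕ
dist G u v = sum (map (λ k → if ball G u k v then 0 else 1) (upTo (N G)))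

nG : (G : Graph) → Fin (N G) → Fin (N G) → ℕ
nG G u v = sum (map (λ w → if dist G w u <ᵇ dist G w v then 1 else 0) (allFin (N G)))

totalMostar : Graph → ℕ
totalMostar G =
  sum (map (λ u → sum (map (λ v → if toℕ u <ᵇ toℕ v then ∣ nG G u v - nG G v u ∣ else 0)
                           (allFin (N G))))
           (allFin (N G)))

-- Vertex 0 is the centre c; vertex 1 + i*b + j (0 ≤ i < a, 0 ≤ j < b) is the
-- j-th vertex of leg i, leg i being the path 1+i*b, 2+i*b, ..., b+i*b, whose
-- endpoint 1+i*b (j = 0) is joined to the centre.
-- (For b = 0 the spider is the single vertex; no edges.)
spiderAdjℕ : ℕ → ℕ → ℕ → Bool
spiderAdjℕ zero    x y = false
spiderAdjℕ (suc c) x y = edge x y ∨ edge y x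
  where
    b = suc c
    leg : ℕ → ℕ
    leg v = (v ∸ 1) / b
    pos : ℕ → ℕ
    pos v = (v ∸ 1) % b
    edge : ℕ → ℕ → Bool
    edge x y =
      ((x ≡ᵇ 0) ∧ not (y ≡ᵇ 0) ∧ (pos y ≡ᵇ 0))
      ∨ (not (x ≡ᵇ 0) ∧ not (y ≡ᵇ 0) ∧ (leg x ≡ᵇ leg y) ∧ (pos y ≡ᵇ suc (pos x)))

spider : ℕ → ℕ → Graph
spider a b = record { N = suc (a * b) ; adj = λ x y → spiderAdjℕ b (toℕ x) (toℕ y) }

module Submission where

-- Write 0 for the centre and 1 + x + k·b for the vertex at depth x on leg k. The breadth-first
-- distance agrees with the closed form δ (depth difference along a leg, depths plus two
-- across the centre), because δ grows by at most one along an edge and every w ≠ u has a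
-- neighbour one step closer to u. Then n(u,v) − n(v,u) = Σ_w sign(d(w,v) − d(w,u)); summed leg
-- by leg, each leg carrying neither u nor v contributes ±b, while on the legs of u and v the
-- comparison is between twice a depth and a fixed threshold. Hence |n(u,v) − n(v,u)| is
-- (a−2)b + q + 1 between the centre and depth q, (a−2)b + p + q + 2 between depths p ≠ q of one
-- leg, (a−2)b + |p − q| between depths p ≠ q of different legs, and 0 between equal depths of
-- different legs. Summing over ordered pairs makes 2·Mo* a polynomial in a, b, Σ q and
-- Σ |p − q|, and 2 Σ q = b² − b, 3 Σ |p − q| = b³ − b give the formula.

open import Defs

open import Data.Nat as ℕ
  using (ℕ; zero; suc; z≤n; s≤s; _≤_; _<_; _∸_; ∣_-_∣; _<ᵇ_; _≡ᵇ_)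
import Data.Nat.Properties as ℕ
open import Data.Nat.DivMod
open import Data.Integer as ℤ using (ℤ; +_; -_; _+_; _-_)
import Data.Integer.Properties as ℤ
open import Data.Integer.Tactic.RingSolver using (solve-∀)
open import Data.Nat.Tactic.RingSolver using () renaming (solve-∀ to ℕ-solve-∀)
open import Data.Bool using (Bool; true; false; _∧_; _∨_; not; if_then_else_)
open import Data.Bool.Properties using (T-≡; ∨-zeroʳ; ∧-zeroʳ)
open import Data.Product using (Σ-syntax; _×_; _,_; proj₁; proj₂)
open import Data.Sum using (_⊎_; inj₁; inj₂)
open import Function.Bundles using (Equivalence)
open import Relation.Nullary using (yes; no; contradiction)
open import Relation.Binary using (Tri; tri<; tri≈; tri>)
open import Data.Fin as Fin using (Fin; toℕ)
import Data.Fin.Properties as Fin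
open import Data.List using (map; applyUpTo; tabulate; allFin; upTo)
open import Data.List.Properties using (map-cong; map-tabulate)
open import Data.Bool.ListAction using (any; or)
open import Data.Nat.ListAction using (sum)
open import Function using (_∘_)
open import Relation.Binary.PropositionalEquality
open import Algebra.Properties.CommutativeSemigroup ℤ.+-commutativeSemigroup
  using () renaming (interchange to +-interchange; x∙yz≈y∙xz to +-left-comm; xy∙z≈x∙zy to +-right-comm)
open import Algebra.Properties.CommutativeSemigroup ℕ.+-commutativeSemigroup
  using () renaming (x∙yz≈y∙xz to ℕ-+-left-comm)

module Booleans where

  <ᵇ≡true : ∀ {m n} → m < n → (m <ᵇ n) ≡ true
  <ᵇ≡true m<n = Equivalence.to T-≡ (ℕ.<⇒<ᵇ m<n)

  <ᵇ≡false : ∀ {m n} → n ≤ m → (m <ᵇ n) ≡ false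
  <ᵇ≡false {m} {n} n≤m with m <ᵇ n in eq
  ... | false = refl
  ... | true  = contradiction (ℕ.<ᵇ⇒< m n (Equivalence.from T-≡ eq)) (ℕ.≤⇒≯ n≤m)

  ≡ᵇ≡true⇒≡ : ∀ {m n} → (m ≡ᵇ n) ≡ true → m ≡ n
  ≡ᵇ≡true⇒≡ {m} {n} eq = ℕ.≡ᵇ⇒≡ m n (Equivalence.from T-≡ eq)

  ≡⇒≡ᵇ≡true : ∀ {m n} → m ≡ n → (m ≡ᵇ n) ≡ true
  ≡⇒≡ᵇ≡true {m} {n} m≡n = Equivalence.to T-≡ (ℕ.≡⇒≡ᵇ m n m≡n)

  ≢⇒≡ᵇ≡false : ∀ {m n} → m ≢ n → (m ≡ᵇ n) ≡ false
  ≢⇒≡ᵇ≡false {m} {n} m≢n with m ≡ᵇ n in eq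
  ... | false = refl
  ... | true  = contradiction (≡ᵇ≡true⇒≡ eq) m≢n

  ≡ᵇ≡false⇒≢ : ∀ {m n} → (m ≡ᵇ n) ≡ false → m ≢ n
  ≡ᵇ≡false⇒≢ {m} m≡ᵇn≡false m≡n with () ← trans (sym m≡ᵇn≡false) (≡⇒≡ᵇ≡true {m} m≡n)

  ∨≡true⇒ : ∀ x {y} → x ∨ y ≡ true → x ≡ true ⊎ y ≡ true
  ∨≡true⇒ true  _ = inj₁ refl
  ∨≡true⇒ false e = inj₂ e

  ∧≡true⇒ : ∀ x {y} → x ∧ y ≡ true → x ≡ true × y ≡ true
  ∧≡true⇒ true e = refl , e

  any-tabulate-true : ∀ {n} {X : Set} (p : X → Bool) (g : Fin n → X) i → p (g i) ≡ true → any p (tabulate g) ≡ true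
  any-tabulate-true p g Fin.zero    pgi rewrite pgi = refl
  any-tabulate-true p g (Fin.suc i) pgi =
    trans (cong (p (g Fin.zero) ∨_) (any-tabulate-true p (g ∘ Fin.suc) i pgi)) (∨-zeroʳ _)

  any-tabulate-false : ∀ {n} {X : Set} (p : X → Bool) (g : Fin n → X) → (∀ i → p (g i) ≡ false) → any p (tabulate g) ≡ false
  any-tabulate-false {zero}  p g _   = refl
  any-tabulate-false {suc n} p g pg≡ rewrite pg≡ Fin.zero = any-tabulate-false p (g ∘ Fin.suc) (pg≡ ∘ Fin.suc)

open Booleans

module FiniteSum where

  open import Data.Integer using (_*_)

  sumℕ : ℕ → (ℕ → ℕ) → ℕ
  sumℕ zero    f = 0
  sumℕ (suc n) f = f 0 ℕ.+ sumℕ n (f ∘ suc)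

  ∑ : ℕ → (ℕ → ℤ) → ℤ
  ∑ zero    f = + 0
  ∑ (suc n) f = f 0 + ∑ n (f ∘ suc)

  infixr 8 ∑
  syntax ∑ n (λ i → x) = ∑[ i < n ] x

  sum-map-upTo : ∀ (f : ℕ → ℕ) n → sum (map f (upTo n)) ≡ sumℕ n f
  sum-map-upTo f n = go f n
    where
    go : ∀ (f : ℕ → ℕ) {g : ℕ → ℕ} n → sum (map f (applyUpTo g n)) ≡ sumℕ n (f ∘ g)
    go f zero    = refl
    go f {g} (suc n) = cong (f (g 0) ℕ.+_) (go f {g ∘ suc} n)

  sum-map-allFin : ∀ n (f : Fin n → ℕ) (g : ℕ → ℕ) → (∀ i → f i ≡ g (toℕ i)) → sum (map f (allFin n)) ≡ sumℕ n g
  sum-map-allFin n f g f≗g = trans (cong sum (map-tabulate (λ i → i) f)) (go n f g f≗g)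
    where
    go : ∀ n (f : Fin n → ℕ) (g : ℕ → ℕ) → (∀ i → f i ≡ g (toℕ i)) → sum (tabulate f) ≡ sumℕ n g
    go zero    f g f≗g = refl
    go (suc n) f g f≗g = cong₂ ℕ._+_ (f≗g Fin.zero) (go n (f ∘ Fin.suc) (g ∘ suc) (f≗g ∘ Fin.suc))

  sumℕ-cong : ∀ n {f g : ℕ → ℕ} → (∀ i → i < n → f i ≡ g i) → sumℕ n f ≡ sumℕ n g
  sumℕ-cong zero    f≗g = refl
  sumℕ-cong (suc n) f≗g = cong₂ ℕ._+_ (f≗g 0 (s≤s z≤n)) (sumℕ-cong n (λ i i<n → f≗g (suc i) (s≤s i<n)))

  pos-sumℕ : ∀ n f → + sumℕ n f ≡ ∑[ i < n ] + f i
  pos-sumℕ zero    f = refl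
  pos-sumℕ (suc n) f = trans (ℤ.pos-+ (f 0) (sumℕ n (f ∘ suc))) (cong (λ s → + f 0 + s) (pos-sumℕ n (f ∘ suc)))

  count-below : ∀ n d → d ≤ n → sumℕ n (λ k → if k <ᵇ d then 1 else 0) ≡ d
  count-below zero    zero    z≤n       = refl
  count-below (suc n) zero    _         = count-below n zero z≤n
  count-below (suc n) (suc d) (s≤s d≤n) = cong suc (count-below n d d≤n)

  ∑-cong : ∀ n {f g : ℕ → ℤ} → (∀ i → i < n → f i ≡ g i) → ∑ n f ≡ ∑ n g
  ∑-cong zero    f≗g = refl
  ∑-cong (suc n) f≗g = cong₂ _+_ (f≗g 0 (s≤s z≤n)) (∑-cong n (λ i i<n → f≗g (suc i) (s≤s i<n)))

  ∑-distrib-+ : ∀ n (f g : ℕ → ℤ) → ∑[ i < n ] (f i + g i) ≡ ∑ n f + ∑ n g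
  ∑-distrib-+ zero    f g = refl
  ∑-distrib-+ (suc n) f g = trans (cong (λ s → f 0 + g 0 + s) (∑-distrib-+ n (f ∘ suc) (g ∘ suc)))
                                  (+-interchange (f 0) (g 0) (∑ n (f ∘ suc)) (∑ n (g ∘ suc)))

  ∑-neg : ∀ n (f : ℕ → ℤ) → ∑[ i < n ] - f i ≡ - ∑ n f
  ∑-neg zero    f = refl
  ∑-neg (suc n) f = trans (cong (λ s → - f 0 + s) (∑-neg n (f ∘ suc))) (sym (ℤ.neg-distrib-+ (f 0) (∑ n (f ∘ suc))))

  ∑-distrib-minus : ∀ n (f g : ℕ → ℤ) → ∑[ i < n ] (f i - g i) ≡ ∑ n f - ∑ n g
  ∑-distrib-minus n f g = trans (∑-distrib-+ n f (λ i → - g i)) (cong (_+_ (∑ n f)) (∑-neg n g))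

  ∑-*ˡ : ∀ n (c : ℤ) (f : ℕ → ℤ) → ∑[ i < n ] (c * f i) ≡ c * ∑ n f
  ∑-*ˡ zero    c f = sym (ℤ.*-zeroʳ c)
  ∑-*ˡ (suc n) c f = trans (cong (λ s → c * f 0 + s) (∑-*ˡ n c (f ∘ suc))) (sym (ℤ.*-distribˡ-+ c (f 0) (∑ n (f ∘ suc))))

  ∑-const : ∀ n (c : ℤ) → ∑[ i < n ] c ≡ + n * c
  ∑-const zero    c = refl
  ∑-const (suc n) c = begin
    c + ∑[ i < n ] c ≡⟨ cong (_+_ c) (∑-const n c) ⟩
    c + + n * c      ≡⟨ cong (_+ + n * c) (sym (ℤ.*-identityˡ c)) ⟩
    + 1 * c + + n * c ≡⟨ ℤ.*-distribʳ-+ c (+ 1) (+ n) ⟨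
    + suc n * c      ∎
    where open ≡-Reasoning

  ∑-+ : ∀ m n (f : ℕ → ℤ) → ∑ (m ℕ.+ n) f ≡ ∑ m f + ∑[ i < n ] f (m ℕ.+ i)
  ∑-+ zero    n f = sym (ℤ.+-identityˡ _)
  ∑-+ (suc m) n f = trans (cong (_+_ (f 0)) (∑-+ m n (f ∘ suc))) (sym (ℤ.+-assoc (f 0) _ _))

  ∑-init-last : ∀ n (f : ℕ → ℤ) → ∑ (suc n) f ≡ ∑ n f + f n
  ∑-init-last n f = begin
    ∑ (suc n) f                     ≡⟨ cong (λ k → ∑ k f) (ℕ.+-comm 1 n) ⟩
    ∑ (n ℕ.+ 1) f                   ≡⟨ ∑-+ n 1 f ⟩
    ∑ n f + (f (n ℕ.+ 0) + + 0)     ≡⟨ cong (λ x → ∑ n f + x) (trans (ℤ.+-identityʳ _) (cong f (ℕ.+-identityʳ n))) ⟩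
    ∑ n f + f n                     ∎
    where open ≡-Reasoning

  ∑-comm : ∀ m n (f : ℕ → ℕ → ℤ) → ∑[ i < m ] ∑[ j < n ] f i j ≡ ∑[ j < n ] ∑[ i < m ] f i j
  ∑-comm zero    n f = sym (trans (∑-const n (+ 0)) (ℤ.*-zeroʳ (+ n)))
  ∑-comm (suc m) n f = trans (cong (_+_ (∑ n (f 0))) (∑-comm m n (f ∘ suc)))
                             (sym (∑-distrib-+ n (f 0) (λ j → ∑[ i < m ] f (suc i) j)))

  ∑-blocks : ∀ a b (f : ℕ → ℤ) → ∑ (a ℕ.* b) f ≡ ∑[ k < a ] ∑[ x < b ] f (x ℕ.+ k ℕ.* b)
  ∑-blocks zero    b f = refl
  ∑-blocks (suc a) b f = begin
    ∑ (b ℕ.+ a ℕ.* b) f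
      ≡⟨ ∑-+ b (a ℕ.* b) f ⟩
    ∑ b f + ∑[ i < a ℕ.* b ] f (b ℕ.+ i)
      ≡⟨ cong₂ _+_ (∑-cong b (λ x _ → cong f (sym (ℕ.+-identityʳ x)))) (∑-blocks a b (λ i → f (b ℕ.+ i))) ⟩
    ∑[ x < b ] f (x ℕ.+ 0) + ∑[ k < a ] ∑[ x < b ] f (b ℕ.+ (x ℕ.+ k ℕ.* b))
      ≡⟨ cong (_+_ (∑[ x < b ] f (x ℕ.+ 0))) (∑-cong a (λ k _ → ∑-cong b (λ x _ → cong f (ℕ-+-left-comm b x (k ℕ.* b))))) ⟩
    ∑[ x < b ] f (x ℕ.+ 0) + ∑[ k < a ] ∑[ x < b ] f (x ℕ.+ suc k ℕ.* b)
      ∎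
    where open ≡-Reasoning

  ∑-select : ∀ n i (f g : ℕ → ℤ) → i < n →
             ∑[ k < n ] (if k ≡ᵇ i then f k else g k) + g i ≡ f i + ∑ n g
  ∑-select (suc n) zero    f g _ = +-right-comm (f 0) (∑ n (g ∘ suc)) (g 0)
  ∑-select (suc n) (suc i) f g (s≤s i<n) = begin
    g 0 + ∑[ k < n ] (if k ≡ᵇ i then f (suc k) else g (suc k)) + g (suc i)
      ≡⟨ ℤ.+-assoc (g 0) _ _ ⟩
    g 0 + (∑[ k < n ] (if k ≡ᵇ i then f (suc k) else g (suc k)) + g (suc i))
      ≡⟨ cong (_+_ (g 0)) (∑-select n i (f ∘ suc) (g ∘ suc) i<n) ⟩
    g 0 + (f (suc i) + ∑ n (g ∘ suc))
      ≡⟨ +-left-comm (g 0) (f (suc i)) _ ⟩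
    f (suc i) + (g 0 + ∑ n (g ∘ suc))
      ∎
    where open ≡-Reasoning

  ∑-select-const : ∀ n i (x y : ℤ) → i < n → ∑[ k < n ] (if k ≡ᵇ i then x else y) + y ≡ x + + n * y
  ∑-select-const n i x y i<n = trans (∑-select n i (λ _ → x) (λ _ → y) i<n) (cong (_+_ x) (∑-const n y))

  ∑-select₂-const : ∀ n i j (x y z : ℤ) → i < n → j < n → i ≢ j →
    ∑[ k < n ] (if k ≡ᵇ i then x else if k ≡ᵇ j then y else z) + z + z ≡ x + y + + n * z
  ∑-select₂-const n i j x y z i<n j<n i≢j = begin
    ∑ n F + z + z                   ≡⟨ cong (λ w → ∑ n F + w + z) (cong (if_then y else z) (≢⇒≡ᵇ≡false i≢j)) ⟨
    ∑ n F + G i + z                 ≡⟨ cong (_+ z) (∑-select n i (λ _ → x) G i<n) ⟩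
    x + ∑ n G + z                   ≡⟨ ℤ.+-assoc x (∑ n G) z ⟩
    x + (∑ n G + z)                 ≡⟨ cong (_+_ x) (∑-select-const n j y z j<n) ⟩
    x + (y + + n * z)               ≡⟨ ℤ.+-assoc x y _ ⟨
    x + y + + n * z                 ∎
    where
    open ≡-Reasoning
    G F : ℕ → ℤ
    G k = if k ≡ᵇ j then y else z
    F k = if k ≡ᵇ i then x else G k

  ∑∑-upper : ∀ n (e : ℕ → ℕ → ℕ) → (∀ u v → e u v ≡ e v u) → (∀ u → e u u ≡ 0) →
    + 2 * + sumℕ n (λ u → sumℕ n (λ v → if u <ᵇ v then e u v else 0)) ≡ ∑[ u < n ] ∑[ v < n ] + e u v
  ∑∑-upper n e e-sym e-diag = sym (begin
    ∑[ u < n ] ∑[ v < n ] + e u v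
      ≡⟨ ∑-cong n (λ u _ → ∑-cong n (λ v _ → split u v)) ⟩
    ∑[ u < n ] ∑[ v < n ] (U u v + U v u)
      ≡⟨ ∑-cong n (λ u _ → ∑-distrib-+ n (U u) (λ v → U v u)) ⟩
    ∑[ u < n ] (∑ n (U u) + ∑[ v < n ] U v u)
      ≡⟨ ∑-distrib-+ n (λ u → ∑ n (U u)) (λ u → ∑[ v < n ] U v u) ⟩
    ∑[ u < n ] ∑ n (U u) + ∑[ u < n ] ∑[ v < n ] U v u
      ≡⟨ cong (_+_ (∑[ u < n ] ∑ n (U u))) (∑-comm n n (λ u v → U v u)) ⟩
    ∑[ u < n ] ∑ n (U u) + ∑[ u < n ] ∑ n (U u)
      ≡⟨ cong (λ t → t + t) upper ⟨
    T + T
      ≡⟨ double T ⟩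
    + 2 * T ∎)
    where
    open ≡-Reasoning
    U : ℕ → ℕ → ℤ
    U u v = + (if u <ᵇ v then e u v else 0)
    T = + sumℕ n (λ u → sumℕ n (λ v → if u <ᵇ v then e u v else 0))
    upper : T ≡ ∑[ u < n ] ∑ n (U u)
    upper = trans (pos-sumℕ n _) (∑-cong n (λ u _ → pos-sumℕ n _))
    double : ∀ t → t + t ≡ + 2 * t
    double = solve-∀
    split : ∀ u v → + e u v ≡ U u v + U v u
    split u v with ℕ.<-cmp u v
    ... | tri< u<v _ _ rewrite <ᵇ≡true u<v | <ᵇ≡false {v} {u} (ℕ.<⇒≤ u<v) = sym (ℤ.+-identityʳ _)
    ... | tri≈ _ refl _ rewrite <ᵇ≡false {u} {u} ℕ.≤-refl | e-diag u = refl
    ... | tri> _ _ v<u rewrite <ᵇ≡true v<u | <ᵇ≡false {u} {v} (ℕ.<⇒≤ v<u) = cong +_ (e-sym u v)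

  ∑-linear : ∀ n (x y : ℤ) → ∑[ i < n ] (x + y * + i) ≡ + n * x + y * ∑[ i < n ] + i
  ∑-linear n x y = trans (∑-distrib-+ n (λ _ → x) (λ i → y * + i)) (cong₂ _+_ (∑-const n x) (∑-*ˡ n y (λ i → + i)))

open FiniteSum

module PowerSums where

  open import Data.Integer using (_*_)

  2∑i : ∀ n → + 2 * ∑[ i < n ] + i ≡ + n * + n - + n
  2∑i zero    = refl
  2∑i (suc n) = begin
    + 2 * ∑[ i < suc n ] + i         ≡⟨ cong (+ 2 *_) (∑-init-last n (λ i → + i)) ⟩
    + 2 * (∑[ i < n ] + i + + n)     ≡⟨ ℤ.*-distribˡ-+ (+ 2) (∑[ i < n ] + i) (+ n) ⟩
    + 2 * ∑[ i < n ] + i + + 2 * + n ≡⟨ cong (_+ + 2 * + n) (2∑i n) ⟩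
    + n * + n - + n + + 2 * + n      ≡⟨ step (+ n) ⟩
    + suc n * + suc n - + suc n      ∎
    where
    open ≡-Reasoning
    step : ∀ x → x * x - x + + 2 * x ≡ (+ 1 + x) * (+ 1 + x) - (+ 1 + x)
    step = solve-∀

  ∑∣i-n∣ : ∀ n → ∑[ i < n ] + ∣ i - n ∣ ≡ + n * + n - ∑[ i < n ] + i
  ∑∣i-n∣ n = begin
    ∑[ i < n ] + ∣ i - n ∣    ≡⟨ ∑-cong n (λ i i<n → trans (cong +_ (ℕ.m≤n⇒∣m-n∣≡n∸m (ℕ.<⇒≤ i<n)))
                                                           (sym (trans (ℤ.m-n≡m⊖n n i) (ℤ.⊖-≥ (ℕ.<⇒≤ i<n))))) ⟩
    ∑[ i < n ] (+ n - + i)    ≡⟨ ∑-distrib-minus n (λ _ → + n) (λ i → + i) ⟩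
    ∑[ i < n ] + n - ∑[ i < n ] + i ≡⟨ cong (_- ∑[ i < n ] + i) (∑-const n (+ n)) ⟩
    + n * + n - ∑[ i < n ] + i ∎
    where open ≡-Reasoning

  3∑∑∣i-j∣ : ∀ n → + 3 * ∑[ i < n ] ∑[ j < n ] + ∣ i - j ∣ ≡ + n * + n * + n - + n
  3∑∑∣i-j∣ zero    = refl
  3∑∑∣i-j∣ (suc n) = begin
    + 3 * ∑[ i < suc n ] ∑[ j < suc n ] + ∣ i - j ∣
      ≡⟨ cong (+ 3 *_) grow ⟩
    + 3 * (∑[ i < n ] ∑[ j < n ] + ∣ i - j ∣ + T + T)
      ≡⟨ distribute (∑[ i < n ] ∑[ j < n ] + ∣ i - j ∣) T ⟩
    + 3 * ∑[ i < n ] ∑[ j < n ] + ∣ i - j ∣ + + 6 * T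
      ≡⟨ cong₂ (λ s t → s + + 6 * t) (3∑∑∣i-j∣ n) (∑∣i-n∣ n) ⟩
    (+ n * + n * + n - + n) + + 6 * (+ n * + n - ∑[ i < n ] + i)
      ≡⟨ expand (+ n) (∑[ i < n ] + i) ⟩
    (+ n * + n * + n - + n) + + 6 * (+ n * + n) - + 3 * (+ 2 * ∑[ i < n ] + i)
      ≡⟨ cong (λ t → (+ n * + n * + n - + n) + + 6 * (+ n * + n) - + 3 * t) (2∑i n) ⟩
    (+ n * + n * + n - + n) + + 6 * (+ n * + n) - + 3 * (+ n * + n - + n)
      ≡⟨ collect (+ n) ⟩
    + suc n * + suc n * + suc n - + suc n ∎
    where
    open ≡-Reasoning
    T = ∑[ i < n ] + ∣ i - n ∣
    distribute : ∀ s t → + 3 * (s + t + t) ≡ + 3 * s + + 6 * t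
    distribute = solve-∀
    expand : ∀ x s → (x * x * x - x) + + 6 * (x * x - s) ≡ (x * x * x - x) + + 6 * (x * x) - + 3 * (+ 2 * s)
    expand = solve-∀
    collect : ∀ x → (x * x * x - x) + + 6 * (x * x) - + 3 * (x * x - x) ≡ (+ 1 + x) * (+ 1 + x) * (+ 1 + x) - (+ 1 + x)
    collect = solve-∀
    last-column : ∑[ j < suc n ] + ∣ n - j ∣ ≡ T
    last-column = trans (∑-init-last n (λ j → + ∣ n - j ∣))
      (trans (cong₂ _+_ (∑-cong n (λ j _ → cong +_ (ℕ.∣-∣-comm n j))) (cong +_ (ℕ.∣n-n∣≡0 n))) (ℤ.+-identityʳ T))
    grow : ∑[ i < suc n ] ∑[ j < suc n ] + ∣ i - j ∣ ≡ ∑[ i < n ] ∑[ j < n ] + ∣ i - j ∣ + T + T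
    grow = begin
      ∑[ i < suc n ] ∑[ j < suc n ] + ∣ i - j ∣
        ≡⟨ ∑-init-last n (λ i → ∑[ j < suc n ] + ∣ i - j ∣) ⟩
      ∑[ i < n ] ∑[ j < suc n ] + ∣ i - j ∣ + ∑[ j < suc n ] + ∣ n - j ∣
        ≡⟨ cong₂ _+_ (∑-cong n (λ i _ → ∑-init-last n (λ j → + ∣ i - j ∣))) last-column ⟩
      ∑[ i < n ] (∑[ j < n ] + ∣ i - j ∣ + + ∣ i - n ∣) + T
        ≡⟨ cong (_+ T) (∑-distrib-+ n (λ i → ∑[ j < n ] + ∣ i - j ∣) (λ i → + ∣ i - n ∣)) ⟩
      ∑[ i < n ] ∑[ j < n ] + ∣ i - j ∣ + T + T ∎

open PowerSums

module Sign where

  sign : ℕ → ℕ → ℤ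
  sign p q = (if q <ᵇ p then + 1 else + 0) - (if p <ᵇ q then + 1 else + 0)

  sign-> : ∀ {p q} → q < p → sign p q ≡ + 1
  sign-> {p} {q} q<p rewrite <ᵇ≡true q<p | <ᵇ≡false {p} {q} (ℕ.<⇒≤ q<p) = refl

  sign-< : ∀ {p q} → p < q → sign p q ≡ - + 1
  sign-< {p} {q} p<q rewrite <ᵇ≡true p<q | <ᵇ≡false {q} {p} (ℕ.<⇒≤ p<q) = refl

  sign-refl : ∀ p → sign p p ≡ + 0
  sign-refl p rewrite <ᵇ≡false {p} {p} ℕ.≤-refl = refl

  sign-+ˡ : ∀ n p q → sign (n ℕ.+ p) (n ℕ.+ q) ≡ sign p q
  sign-+ˡ zero    p q = refl
  sign-+ˡ (suc n) p q = sign-+ˡ n p q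

  sign-∸ : ∀ {p q} → q ≤ p → ∀ r → sign (p ∸ q) r ≡ sign p (q ℕ.+ r)
  sign-∸ {p} {q} q≤p r = trans (sym (sign-+ˡ q (p ∸ q) r)) (cong (λ x → sign x (q ℕ.+ r)) (ℕ.m+[n∸m]≡n q≤p))

  ∣m-n∣≡∣m⊖n∣ : ∀ m n → ∣ m - n ∣ ≡ ℤ.∣ m ℤ.⊖ n ∣
  ∣m-n∣≡∣m⊖n∣ zero    zero    = refl
  ∣m-n∣≡∣m⊖n∣ zero    (suc n) = refl
  ∣m-n∣≡∣m⊖n∣ (suc m) zero    = refl
  ∣m-n∣≡∣m⊖n∣ (suc m) (suc n) = trans (∣m-n∣≡∣m⊖n∣ m n) (cong ℤ.∣_∣ (sym (ℤ.[1+m]⊖[1+n]≡m⊖n m n)))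

  sign-∣-∣ : ∀ {s t} y → s < t → sign ∣ y - t ∣ ∣ y - s ∣ ≡ sign (s ℕ.+ t) (y ℕ.+ y)
  sign-∣-∣ {s} {t} y s<t with y ℕ.≤? s | t ℕ.≤? y
  ... | yes y≤s | _ rewrite ℕ.m≤n⇒∣m-n∣≡n∸m y≤s | ℕ.m≤n⇒∣m-n∣≡n∸m (ℕ.≤-trans y≤s (ℕ.<⇒≤ s<t)) =
    trans (sign-> (ℕ.∸-monoˡ-< s<t y≤s)) (sym (sign-> (ℕ.+-mono-≤-< y≤s (ℕ.≤-<-trans y≤s s<t))))
  ... | no _ | yes t≤y rewrite ℕ.m≤n⇒∣n-m∣≡n∸m t≤y | ℕ.m≤n⇒∣n-m∣≡n∸m (ℕ.≤-trans (ℕ.<⇒≤ s<t) t≤y) =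
    trans (sign-< (ℕ.∸-monoʳ-< s<t t≤y)) (sym (sign-< (ℕ.+-mono-<-≤ (ℕ.<-≤-trans s<t t≤y) t≤y)))
  ... | no y≰s | no t≰y = between (ℕ.<⇒≤ (ℕ.≰⇒> y≰s)) (ℕ.<⇒≤ (ℕ.≰⇒> t≰y))
    where
    between : s ≤ y → y ≤ t → sign ∣ y - t ∣ ∣ y - s ∣ ≡ sign (s ℕ.+ t) (y ℕ.+ y)
    between s≤y y≤t rewrite ℕ.m≤n⇒∣m-n∣≡n∸m y≤t | ℕ.m≤n⇒∣n-m∣≡n∸m s≤y = begin
      sign (t ∸ y) (y ∸ s)                               ≡⟨ sign-+ˡ (s ℕ.+ y) (t ∸ y) (y ∸ s) ⟨
      sign (s ℕ.+ y ℕ.+ (t ∸ y)) (s ℕ.+ y ℕ.+ (y ∸ s)) ≡⟨ cong₂ sign E1 E2 ⟩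
      sign (s ℕ.+ t) (y ℕ.+ y)                           ∎
      where
      open ≡-Reasoning
      E1 : s ℕ.+ y ℕ.+ (t ∸ y) ≡ s ℕ.+ t
      E1 = trans (ℕ.+-assoc s y _) (cong (s ℕ.+_) (ℕ.m+[n∸m]≡n y≤t))
      E2 : s ℕ.+ y ℕ.+ (y ∸ s) ≡ y ℕ.+ y
      E2 = trans (cong (ℕ._+ (y ∸ s)) (ℕ.+-comm s y)) (trans (ℕ.+-assoc y s _) (cong (y ℕ.+_) (ℕ.m+[n∸m]≡n s≤y)))

  sign-∣-∣-through-centre : ∀ x {p q} → p < q →
    sign ∣ x - q ∣ (suc x ℕ.+ suc p) ≡ sign (q ∸ p) (suc x ℕ.+ suc x)
  sign-∣-∣-through-centre x {p} {q} p<q with q ℕ.≤? x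
  ... | yes q≤x rewrite ℕ.m≤n⇒∣n-m∣≡n∸m q≤x =
    trans (sign-< (ℕ.≤-<-trans (ℕ.m∸n≤m x q) (ℕ.m≤m+n (suc x) (suc p))))
          (sym (sign-< (ℕ.≤-<-trans (ℕ.m∸n≤m q p) (ℕ.≤-<-trans q≤x (ℕ.m≤m+n (suc x) (suc x))))))
  ... | no q≰x rewrite ℕ.m≤n⇒∣m-n∣≡n∸m (ℕ.<⇒≤ (ℕ.≰⇒> q≰x)) = begin
    sign (q ∸ x) (suc x ℕ.+ suc p)          ≡⟨ sign-∸ (ℕ.<⇒≤ (ℕ.≰⇒> q≰x)) _ ⟩
    sign q (x ℕ.+ (suc x ℕ.+ suc p))        ≡⟨ cong (sign q) (reassociate x p) ⟩
    sign q (p ℕ.+ (suc x ℕ.+ suc x))        ≡⟨ sign-∸ (ℕ.<⇒≤ p<q) _ ⟨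
    sign (q ∸ p) (suc x ℕ.+ suc x)          ∎
    where
    open ≡-Reasoning
    reassociate : ∀ x p → x ℕ.+ (suc x ℕ.+ suc p) ≡ p ℕ.+ (suc x ℕ.+ suc x)
    reassociate = ℕ-solve-∀

  balance : ℕ → ℕ → ℤ
  balance b m = ∑[ x < b ] sign m (suc x ℕ.+ suc x)

  balance-suc : ∀ b m → balance (suc b) m ≡ balance b m + sign m (suc b ℕ.+ suc b)
  balance-suc b m = ∑-init-last b (λ x → sign m (suc x ℕ.+ suc x))

  balance-≥ : ∀ b m → suc (b ℕ.+ b) ≤ m → balance b m ≡ + b
  balance-≥ zero    m _       = refl
  balance-≥ (suc b) m 2b+3≤m = begin
    balance (suc b) m                      ≡⟨ balance-suc b m ⟩
    balance b m + sign m (suc b ℕ.+ suc b) ≡⟨ cong₂ _+_ (balance-≥ b m 2b+1≤m) (sign-> 2b+3≤m) ⟩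
    + b + + 1                              ≡⟨ cong +_ (ℕ.+-comm b 1) ⟩
    + suc b                                ∎
    where
    open ≡-Reasoning
    2b+1≤m : suc (b ℕ.+ b) ≤ m
    2b+1≤m = ℕ.≤-trans (s≤s (ℕ.+-monoʳ-≤ b (ℕ.n≤1+n b))) (ℕ.<⇒≤ 2b+3≤m)

  balance-≤ : ∀ b m → 1 ≤ m → m ≤ suc (b ℕ.+ b) → balance b m + + b + + 1 ≡ + m
  balance-≤ zero    (suc zero)    _ _         = refl
  balance-≤ zero    (suc (suc m)) _ (s≤s ())
  balance-≤ (suc b) m 1≤m m≤2b+3 = begin
    balance (suc b) m + + suc b + + 1
      ≡⟨ cong (λ k → k + + suc b + + 1) (balance-suc b m) ⟩
    balance b m + sign m (suc b ℕ.+ suc b) + (+ 1 + + b) + + 1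
      ≡⟨ regroup (balance b m) (sign m (suc b ℕ.+ suc b)) (+ b) ⟩
    (balance b m + + b + + 1) + (sign m (suc b ℕ.+ suc b) + + 1)
      ≡⟨ last-term (ℕ.<-cmp m (suc b ℕ.+ suc b)) ⟩
    + m ∎
    where
    open ≡-Reasoning
    regroup : ∀ k s b → k + s + (+ 1 + b) + + 1 ≡ (k + b + + 1) + (s + + 1)
    regroup = solve-∀
    2b+1≤2b+2 : suc (b ℕ.+ b) ≤ suc b ℕ.+ suc b
    2b+1≤2b+2 = s≤s (ℕ.+-monoʳ-≤ b (ℕ.n≤1+n b))
    last-term : Tri (m < suc b ℕ.+ suc b) (m ≡ suc b ℕ.+ suc b) (suc b ℕ.+ suc b < m) →
                (balance b m + + b + + 1) + (sign m (suc b ℕ.+ suc b) + + 1) ≡ + m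
    last-term (tri< m<2b+2 _ _) rewrite sign-< m<2b+2 =
      trans (ℤ.+-identityʳ _) (balance-≤ b m 1≤m (subst (m ≤_) (ℕ.+-suc b b) (ℕ.≤-pred m<2b+2)))
    last-term (tri≈ _ refl _) rewrite sign-refl m | balance-≥ b m 2b+1≤2b+2 =
      cong +_ (b+b+1+1≡2[1+b] b)
      where
      b+b+1+1≡2[1+b] : ∀ b → b ℕ.+ b ℕ.+ 1 ℕ.+ 1 ≡ suc b ℕ.+ suc b
      b+b+1+1≡2[1+b] = ℕ-solve-∀
    last-term (tri> _ _ 2b+2<m) with ℕ.≤-antisym m≤2b+3 2b+2<m
    ... | refl rewrite sign-> 2b+2<m | balance-≥ b m (ℕ.m≤n⇒m≤1+n 2b+1≤2b+2) =
      cong +_ (b+b+1+2≡1+2[1+b] b)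
      where
      b+b+1+2≡1+2[1+b] : ∀ b → b ℕ.+ b ℕ.+ 1 ℕ.+ 2 ≡ suc (suc b ℕ.+ suc b)
      b+b+1+2≡1+2[1+b] = ℕ-solve-∀

open Sign

module SpiderDistance (a c : ℕ) where

  b : ℕ
  b = suc c

  -- Vertex suc m lies on leg m / b at depth m % b; depth 0 is adjacent to the centre 0.
  δ : ℕ → ℕ → ℕ
  δ zero    zero     = 0
  δ zero    (suc m)  = suc (m % b)
  δ (suc m) zero     = suc (m % b)
  δ (suc m) (suc m′) = if m / b ≡ᵇ m′ / b then ∣ m % b - m′ % b ∣ else suc (m % b) ℕ.+ suc (m′ % b)

  adjacent : ℕ → ℕ → Bool
  adjacent = spiderAdjℕ b

  /-%-injective : ∀ {m m′} → m / b ≡ m′ / b → m % b ≡ m′ % b → m ≡ m′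
  /-%-injective {m} {m′} q≡ r≡ = begin
    m                  ≡⟨ m≡m%n+[m/n]*n m b ⟩
    m % b ℕ.+ m / b ℕ.* b   ≡⟨ cong₂ (λ r q → r ℕ.+ q ℕ.* b) r≡ q≡ ⟩
    m′ % b ℕ.+ m′ / b ℕ.* b ≡⟨ m≡m%n+[m/n]*n m′ b ⟨
    m′                 ∎
    where open ≡-Reasoning

  [p+kb]%b≡p : ∀ {p} k → p < b → (p ℕ.+ k ℕ.* b) % b ≡ p
  [p+kb]%b≡p {p} k p<b = trans ([m+kn]%n≡m%n p k b) (m<n⇒m%n≡m p<b)

  [p+kb]/b≡k : ∀ {p} k → p < b → (p ℕ.+ k ℕ.* b) / b ≡ k
  [p+kb]/b≡k {p} k p<b = begin
    (p ℕ.+ k ℕ.* b) / b     ≡⟨ +-distrib-/ p (k ℕ.* b) p%b+kb%b<b ⟩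
    p / b ℕ.+ k ℕ.* b / b   ≡⟨ cong₂ ℕ._+_ (m<n⇒m/n≡0 p<b) (m*n/n≡m k b) ⟩
    k                       ∎
    where
    open ≡-Reasoning
    p%b+kb%b<b : p % b ℕ.+ k ℕ.* b % b < b
    p%b+kb%b<b = subst (_< b) (sym (trans (cong₂ ℕ._+_ (m<n⇒m%n≡m p<b) (m*n%n≡0 k b)) (ℕ.+-identityʳ p))) p<b

  adjacent-suc-suc⇒ : ∀ m m′ → adjacent (suc m) (suc m′) ≡ true →
    m / b ≡ m′ / b × (m′ % b ≡ suc (m % b) ⊎ m % b ≡ suc (m′ % b))
  adjacent-suc-suc⇒ m m′ adj with ∨≡true⇒ ((m / b ≡ᵇ m′ / b) ∧ (m′ % b ≡ᵇ suc (m % b))) adj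
  ... | inj₁ out = let q≡ , r≡ = ∧≡true⇒ (m / b ≡ᵇ m′ / b) out in ≡ᵇ≡true⇒≡ q≡ , inj₁ (≡ᵇ≡true⇒≡ r≡)
  ... | inj₂ in′ = let q≡ , r≡ = ∧≡true⇒ (m′ / b ≡ᵇ m / b) in′ in sym (≡ᵇ≡true⇒≡ q≡) , inj₂ (≡ᵇ≡true⇒≡ r≡)

  adjacent-suc-suc : ∀ m m′ → m / b ≡ m′ / b → m′ % b ≡ suc (m % b) →
    adjacent (suc m) (suc m′) ≡ true × adjacent (suc m′) (suc m) ≡ true
  adjacent-suc-suc m m′ q≡ r≡ rewrite ≡⇒≡ᵇ≡true q≡ | ≡⇒≡ᵇ≡true r≡ = refl , ∨-zeroʳ _

  adjacent-0-suc⇒ : ∀ m → adjacent 0 (suc m) ≡ true → m % b ≡ 0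
  adjacent-0-suc⇒ m adj with m % b ≡ᵇ 0 in eq
  ... | true = ≡ᵇ≡true⇒≡ eq

  adjacent-suc-0⇒ : ∀ m → adjacent (suc m) 0 ≡ true → m % b ≡ 0
  adjacent-suc-0⇒ m adj with m % b ≡ᵇ 0 in eq
  ... | true = ≡ᵇ≡true⇒≡ eq

  adjacent-0-suc : ∀ m → m % b ≡ 0 → adjacent 0 (suc m) ≡ true
  adjacent-0-suc m r≡0 rewrite r≡0 = refl

  adjacent-suc-0 : ∀ m → m % b ≡ 0 → adjacent (suc m) 0 ≡ true
  adjacent-suc-0 m r≡0 rewrite r≡0 = refl

  δ-same-leg : ∀ m m′ → (m / b ≡ᵇ m′ / b) ≡ true → δ (suc m) (suc m′) ≡ ∣ m % b - m′ % b ∣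
  δ-same-leg m m′ eq rewrite eq = refl

  δ-other-leg : ∀ m m′ → (m / b ≡ᵇ m′ / b) ≡ false → δ (suc m) (suc m′) ≡ suc (m % b) ℕ.+ suc (m′ % b)
  δ-other-leg m m′ eq rewrite eq = refl

  δ-refl : ∀ u → δ u u ≡ 0
  δ-refl zero    = refl
  δ-refl (suc m) = trans (δ-same-leg m m (≡⇒≡ᵇ≡true {m / b} refl)) (ℕ.∣n-n∣≡0 (m % b))

  δ≡0⇒≡ : ∀ u w → δ u w ≡ 0 → u ≡ w
  δ≡0⇒≡ zero    zero     _ = refl
  δ≡0⇒≡ (suc m) (suc m′) δ≡0 with m / b ≡ᵇ m′ / b in eq
  ... | true = cong suc (/-%-injective (≡ᵇ≡true⇒≡ eq) (ℕ.∣m-n∣≡0⇒m≡n δ≡0))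

  δ≤2b : ∀ u w → δ u w ≤ b ℕ.+ b
  δ≤2b zero    zero     = z≤n
  δ≤2b zero    (suc m)  = ℕ.≤-trans (m%n<n m b) (ℕ.m≤m+n b b)
  δ≤2b (suc m) zero     = ℕ.≤-trans (m%n<n m b) (ℕ.m≤m+n b b)
  δ≤2b (suc m) (suc m′) with m / b ≡ᵇ m′ / b
  ... | true  = ℕ.≤-trans (ℕ.∣m-n∣≤m⊔n (m % b) (m′ % b))
                  (ℕ.≤-trans (ℕ.⊔-lub (ℕ.<⇒≤ (m%n<n m b)) (ℕ.<⇒≤ (m%n<n m′ b))) (ℕ.m≤m+n b b))
  ... | false = ℕ.+-mono-≤ (m%n<n m b) (m%n<n m′ b)

  ∣m-1+n∣≤1+∣m-n∣ : ∀ m n → ∣ m - suc n ∣ ≤ suc ∣ m - n ∣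
  ∣m-1+n∣≤1+∣m-n∣ zero    n       = ℕ.≤-refl
  ∣m-1+n∣≤1+∣m-n∣ (suc m) zero    = subst (_≤ suc (suc m)) (sym (ℕ.∣-∣-identityʳ m)) (ℕ.m≤n⇒m≤1+n (ℕ.n≤1+n m))
  ∣m-1+n∣≤1+∣m-n∣ (suc m) (suc n) = ∣m-1+n∣≤1+∣m-n∣ m n

  ∣m-n∣≤1+∣m-1+n∣ : ∀ m n → ∣ m - n ∣ ≤ suc ∣ m - suc n ∣
  ∣m-n∣≤1+∣m-1+n∣ zero    n       = ℕ.m≤n⇒m≤1+n (ℕ.n≤1+n n)
  ∣m-n∣≤1+∣m-1+n∣ (suc m) zero    = subst (λ k → suc m ≤ suc k) (sym (ℕ.∣-∣-identityʳ m)) ℕ.≤-refl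
  ∣m-n∣≤1+∣m-1+n∣ (suc m) (suc n) = ∣m-n∣≤1+∣m-1+n∣ m n

  δ-adjacent : ∀ u x w → adjacent x w ≡ true → δ u w ≤ suc (δ u x)
  δ-adjacent zero     zero    (suc m) adj rewrite adjacent-0-suc⇒ m adj = ℕ.≤-refl
  δ-adjacent (suc m″) zero    (suc m) adj with m″ / b ≡ᵇ m / b
  ... | true  rewrite adjacent-0-suc⇒ m adj =
    subst (_≤ suc (suc (m″ % b))) (sym (ℕ.∣-∣-identityʳ (m″ % b))) (ℕ.m≤n⇒m≤1+n (ℕ.n≤1+n _))
  ... | false rewrite adjacent-0-suc⇒ m adj = subst (_≤ suc (suc (m″ % b))) (ℕ.+-comm 1 (suc (m″ % b))) ℕ.≤-refl
  δ-adjacent zero     (suc m) zero    adj = z≤n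
  δ-adjacent (suc m″) (suc m) zero    adj with m″ / b ≡ᵇ m / b
  ... | true  rewrite adjacent-suc-0⇒ m adj = subst (λ k → suc (m″ % b) ≤ suc k) (sym (ℕ.∣-∣-identityʳ (m″ % b))) ℕ.≤-refl
  ... | false rewrite adjacent-suc-0⇒ m adj = s≤s (ℕ.≤-trans (ℕ.n≤1+n _) (ℕ.m≤m+n _ _))
  δ-adjacent zero     (suc m) (suc m′) adj with adjacent-suc-suc⇒ m m′ adj
  ... | _ , inj₁ r≡ rewrite r≡ = ℕ.≤-refl
  ... | _ , inj₂ r≡ rewrite r≡ = ℕ.m≤n⇒m≤1+n (ℕ.n≤1+n _)
  δ-adjacent (suc m″) (suc m) (suc m′) adj with adjacent-suc-suc⇒ m m′ adj
  ... | q≡ , r≡ rewrite q≡ with m″ / b ≡ᵇ m′ / b | r≡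
  ... | true  | inj₁ r≡′ rewrite r≡′ = ∣m-1+n∣≤1+∣m-n∣ (m″ % b) (m % b)
  ... | true  | inj₂ r≡′ rewrite r≡′ = ∣m-n∣≤1+∣m-1+n∣ (m″ % b) (m′ % b)
  ... | false | inj₁ r≡′ rewrite r≡′ = ℕ.≤-reflexive (cong suc (ℕ.+-suc (m″ % b) (suc (m % b))))
  ... | false | inj₂ r≡′ rewrite r≡′ = s≤s (ℕ.≤-trans (ℕ.+-monoʳ-≤ (m″ % b) (ℕ.n≤1+n (suc (m′ % b)))) (ℕ.n≤1+n _))

  order : ℕ
  order = suc (a ℕ.* b)

  inward-neighbour : ∀ m →
    (m % b ≡ 0 × adjacent 0 (suc m) ≡ true) ⊎
    (Σ[ m₁ ∈ ℕ ] m₁ < m × m₁ / b ≡ m / b × suc (m₁ % b) ≡ m % b × adjacent (suc m₁) (suc m) ≡ true)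
  inward-neighbour m = by-depth (m % b) refl
    where
    by-depth : ∀ r → m % b ≡ r →
      (m % b ≡ 0 × adjacent 0 (suc m) ≡ true) ⊎
      (Σ[ m₁ ∈ ℕ ] m₁ < m × m₁ / b ≡ m / b × suc (m₁ % b) ≡ m % b × adjacent (suc m₁) (suc m) ≡ true)
    by-depth zero    r≡ = inj₁ (r≡ , adjacent-0-suc m r≡)
    by-depth (suc p) r≡ = inj₂ (m₁ , m₁<m , q≡ , sym r≡′ , proj₁ (adjacent-suc-suc m₁ m q≡ r≡′))
      where
      p<b : p < b
      p<b = ℕ.≤-trans (ℕ.n≤1+n (suc p)) (subst (λ k → suc k ≤ b) r≡ (m%n<n m b))
      m₁ = p ℕ.+ m / b ℕ.* b
      q≡ : m₁ / b ≡ m / b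
      q≡ = [p+kb]/b≡k (m / b) p<b
      r≡′ : m % b ≡ suc (m₁ % b)
      r≡′ = trans r≡ (cong suc (sym ([p+kb]%b≡p (m / b) p<b)))
      m₁<m : m₁ < m
      m₁<m = subst (m₁ <_) (sym (trans (m≡m%n+[m/n]*n m b) (cong (ℕ._+ m / b ℕ.* b) r≡))) ℕ.≤-refl

  outward-neighbour : ∀ m → m < a ℕ.* b → suc (m % b) < b →
    Σ[ m₂ ∈ ℕ ] m₂ < a ℕ.* b × m₂ / b ≡ m / b × m₂ % b ≡ suc (m % b) × adjacent (suc m₂) (suc m) ≡ true
  outward-neighbour m m<ab r+1<b = m₂ , m₂<ab , q≡ , r≡ , proj₂ (adjacent-suc-suc m m₂ (sym q≡) r≡)
    where
    m₂ = suc (m % b) ℕ.+ m / b ℕ.* b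
    q≡ : m₂ / b ≡ m / b
    q≡ = [p+kb]/b≡k (m / b) r+1<b
    r≡ : m₂ % b ≡ suc (m % b)
    r≡ = [p+kb]%b≡p (m / b) r+1<b
    m₂<ab : m₂ < a ℕ.* b
    m₂<ab = ℕ.≤-trans (ℕ.+-monoˡ-≤ (m / b ℕ.* b) r+1<b) (ℕ.*-monoˡ-≤ b (m<n*o⇒m/o<n {m} {a} m<ab))

  m≤n⇒1+∣m-n∣≡∣m-1+n∣ : ∀ {m n} → m ≤ n → suc ∣ m - n ∣ ≡ ∣ m - suc n ∣
  m≤n⇒1+∣m-n∣≡∣m-1+n∣ z≤n       = refl
  m≤n⇒1+∣m-n∣≡∣m-1+n∣ (s≤s m≤n) = m≤n⇒1+∣m-n∣≡∣m-1+n∣ m≤n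

  n<m⇒1+∣m-1+n∣≡∣m-n∣ : ∀ {m n} → n < m → suc ∣ m - suc n ∣ ≡ ∣ m - n ∣
  n<m⇒1+∣m-1+n∣≡∣m-n∣ {suc m} {zero}  _         = cong suc (ℕ.∣-∣-identityʳ m)
  n<m⇒1+∣m-1+n∣≡∣m-n∣ {suc m} {suc n} (s≤s n<m) = n<m⇒1+∣m-1+n∣≡∣m-n∣ n<m

  Predecessor : ℕ → ℕ → Set
  Predecessor u w = Σ[ x ∈ ℕ ] x < order × adjacent x w ≡ true × suc (δ u x) ≡ δ u w

  predecessor-of-centre : ∀ m → m < a ℕ.* b → Predecessor (suc m) 0
  predecessor-of-centre m m<ab =
    suc m₁ , s≤s (ℕ.≤-<-trans (m/n*n≤m m b) m<ab) , adjacent-suc-0 m₁ r≡ , cong suc δ≡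
    where
    m₁ = 0 ℕ.+ m / b ℕ.* b
    r≡ : m₁ % b ≡ 0
    r≡ = [p+kb]%b≡p (m / b) (s≤s z≤n)
    δ≡ : δ (suc m) (suc m₁) ≡ m % b
    δ≡ = begin
      δ (suc m) (suc m₁) ≡⟨ δ-same-leg m m₁ (≡⇒≡ᵇ≡true (sym ([p+kb]/b≡k (m / b) (s≤s z≤n)))) ⟩
      ∣ m % b - m₁ % b ∣ ≡⟨ cong (λ r → ∣ m % b - r ∣) r≡ ⟩
      ∣ m % b - 0 ∣      ≡⟨ ℕ.∣-∣-identityʳ (m % b) ⟩
      m % b              ∎
      where open ≡-Reasoning

  predecessor-from-centre : ∀ m → suc m < order → Predecessor 0 (suc m)
  predecessor-from-centre m m<n with inward-neighbour m
  ... | inj₁ (r≡0 , adj)                 = 0 , s≤s z≤n , adj , cong suc (sym r≡0)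
  ... | inj₂ (m₁ , m₁<m , _ , r≡ , adj) = suc m₁ , ℕ.<-trans (s≤s m₁<m) m<n , adj , cong suc r≡

  predecessor-same-leg : ∀ m′ m → m < a ℕ.* b → m′ / b ≡ m / b → m′ % b ≢ m % b →
                         Predecessor (suc m′) (suc m)
  predecessor-same-leg m′ m m<ab same r≢ with ℕ.<-cmp (m′ % b) (m % b)
  ... | tri≈ _ r≡ _ = contradiction r≡ r≢
  ... | tri< r′<r _ _ with inward-neighbour m
  ...   | inj₁ (r≡0 , _) = contradiction (subst (m′ % b <_) r≡0 r′<r) ℕ.n≮0
  ...   | inj₂ (m₁ , m₁<m , q≡ , r≡ , adj) = suc m₁ , s≤s (ℕ.<-trans m₁<m m<ab) , adj , δ≡
    where
    δ≡ : suc (δ (suc m′) (suc m₁)) ≡ δ (suc m′) (suc m)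
    δ≡ = begin
      suc (δ (suc m′) (suc m₁)) ≡⟨ cong suc (δ-same-leg m′ m₁ (≡⇒≡ᵇ≡true (trans same (sym q≡)))) ⟩
      suc ∣ m′ % b - m₁ % b ∣  ≡⟨ m≤n⇒1+∣m-n∣≡∣m-1+n∣ (ℕ.≤-pred (subst (m′ % b <_) (sym r≡) r′<r)) ⟩
      ∣ m′ % b - suc (m₁ % b) ∣ ≡⟨ cong (λ r → ∣ m′ % b - r ∣) r≡ ⟩
      ∣ m′ % b - m % b ∣       ≡⟨ δ-same-leg m′ m (≡⇒≡ᵇ≡true same) ⟨
      δ (suc m′) (suc m)       ∎
      where open ≡-Reasoning
  predecessor-same-leg m′ m m<ab same r≢ | tri> _ _ r<r′
    with outward-neighbour m m<ab (ℕ.<-≤-trans (s≤s r<r′) (m%n<n m′ b))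
  ... | m₂ , m₂<ab , q≡ , r≡ , adj = suc m₂ , s≤s m₂<ab , adj , δ≡
    where
    δ≡ : suc (δ (suc m′) (suc m₂)) ≡ δ (suc m′) (suc m)
    δ≡ = begin
      suc (δ (suc m′) (suc m₂)) ≡⟨ cong suc (δ-same-leg m′ m₂ (≡⇒≡ᵇ≡true (trans same (sym q≡)))) ⟩
      suc ∣ m′ % b - m₂ % b ∣  ≡⟨ cong (λ r → suc ∣ m′ % b - r ∣) r≡ ⟩
      suc ∣ m′ % b - suc (m % b) ∣ ≡⟨ n<m⇒1+∣m-1+n∣≡∣m-n∣ r<r′ ⟩
      ∣ m′ % b - m % b ∣       ≡⟨ δ-same-leg m′ m (≡⇒≡ᵇ≡true same) ⟨
      δ (suc m′) (suc m)       ∎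
      where open ≡-Reasoning

  predecessor-other-leg : ∀ m′ m → suc m < order → (m′ / b ≡ᵇ m / b) ≡ false → Predecessor (suc m′) (suc m)
  predecessor-other-leg m′ m m<n other with inward-neighbour m
  ... | inj₁ (r≡0 , adj) = 0 , s≤s z≤n , adj , δ≡
    where
    δ≡ : suc (suc (m′ % b)) ≡ δ (suc m′) (suc m)
    δ≡ = begin
      suc (suc (m′ % b))          ≡⟨ cong suc (ℕ.+-comm 1 (m′ % b)) ⟩
      suc (m′ % b ℕ.+ 1)          ≡⟨ cong (λ r → suc (m′ % b) ℕ.+ suc r) r≡0 ⟨
      suc (m′ % b) ℕ.+ suc (m % b) ≡⟨ δ-other-leg m′ m other ⟨
      δ (suc m′) (suc m)          ∎
      where open ≡-Reasoning
  ... | inj₂ (m₁ , m₁<m , q≡ , r≡ , adj) = suc m₁ , ℕ.<-trans (s≤s m₁<m) m<n , adj , δ≡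
    where
    δ≡ : suc (δ (suc m′) (suc m₁)) ≡ δ (suc m′) (suc m)
    δ≡ = begin
      suc (δ (suc m′) (suc m₁))         ≡⟨ cong suc (δ-other-leg m′ m₁ (trans (cong (m′ / b ≡ᵇ_) q≡) other)) ⟩
      suc (suc (m′ % b) ℕ.+ suc (m₁ % b)) ≡⟨ ℕ.+-suc (suc (m′ % b)) (suc (m₁ % b)) ⟨
      suc (m′ % b) ℕ.+ suc (suc (m₁ % b)) ≡⟨ cong (λ r → suc (m′ % b) ℕ.+ suc r) r≡ ⟩
      suc (m′ % b) ℕ.+ suc (m % b)      ≡⟨ δ-other-leg m′ m other ⟨
      δ (suc m′) (suc m)                ∎
      where open ≡-Reasoning

  predecessor : ∀ u w → u < order → w < order → u ≢ w → Predecessor u w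
  predecessor zero     zero    _         _         u≢w = contradiction refl u≢w
  predecessor (suc m)  zero    (s≤s m<ab) _        _   = predecessor-of-centre m m<ab
  predecessor zero     (suc m) _         m<n       _   = predecessor-from-centre m m<n
  predecessor (suc m′) (suc m) _         (s≤s m<ab) u≢w = by-legs (m′ / b ≡ᵇ m / b) refl
    where
    by-legs : ∀ t → (m′ / b ≡ᵇ m / b) ≡ t → Predecessor (suc m′) (suc m)
    by-legs true  legs = predecessor-same-leg m′ m m<ab same (λ r≡ → u≢w (cong suc (/-%-injective same r≡)))
      where same = ≡ᵇ≡true⇒≡ legs
    by-legs false legs = predecessor-other-leg m′ m (s≤s m<ab) legs

module ShortestPaths (a′ c : ℕ) where

  open SpiderDistance (2 ℕ.+ a′) c public

  G : Graph
  G = spider (2 ℕ.+ a′) b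

  δᶠ : Fin order → Fin order → ℕ
  δᶠ u w = δ (toℕ u) (toℕ w)

  within : ℕ → Fin order → Fin order → Bool
  within k u w = not (k <ᵇ δᶠ u w)

  -- The radius-(k+1) ball is the radius-k ball together with its neighbours, since δ
  -- grows by at most one along an edge and by exactly one along some edge.
  within-suc : ∀ k u w → within k u w ∨ any (λ x → within k u x ∧ adj G x w) (allFin order) ≡ within (suc k) u w
  within-suc k u w = by-δ (δᶠ u w) refl
    where
    by-δ : ∀ d → δᶠ u w ≡ d → not (k <ᵇ d) ∨ any (λ x → within k u x ∧ adj G x w) (allFin order) ≡ not (suc k <ᵇ d)
    by-δ d δ≡d with ℕ.<-cmp d (suc k)
    ... | tri< d<k+1 _ _ rewrite <ᵇ≡false {k} {d} (ℕ.≤-pred d<k+1) | <ᵇ≡false {suc k} {d} (ℕ.<⇒≤ d<k+1) = refl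
    ... | tri≈ _ refl _ rewrite <ᵇ≡true (ℕ.n<1+n k) | <ᵇ≡false {k} {k} ℕ.≤-refl =
      any-tabulate-true (λ x → within k u x ∧ adj G x w) (λ x → x) x pred-within
      where
      u≢w : toℕ u ≢ toℕ w
      u≢w u≡w = ℕ.0≢1+n (trans (sym (trans (cong (δ (toℕ u)) (sym u≡w)) (δ-refl (toℕ u)))) δ≡d)
      pred = predecessor (toℕ u) (toℕ w) (Fin.toℕ<n u) (Fin.toℕ<n w) u≢w
      x : Fin order
      x = Fin.fromℕ< (proj₁ (proj₂ pred))
      pred-within : within k u x ∧ adj G x w ≡ true
      pred-within rewrite Fin.toℕ-fromℕ< (proj₁ (proj₂ pred))
                        | ℕ.suc-injective (trans (proj₂ (proj₂ (proj₂ pred))) δ≡d)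
                        | <ᵇ≡false {k} {k} ℕ.≤-refl = proj₁ (proj₂ (proj₂ pred))
    ... | tri> _ _ k+1<d rewrite <ᵇ≡true (ℕ.<-trans (ℕ.n<1+n k) k+1<d) | <ᵇ≡true k+1<d =
      any-tabulate-false (λ x → within k u x ∧ adj G x w) (λ x → x) not-adjacent
      where
      not-adjacent : ∀ x → within k u x ∧ adj G x w ≡ false
      not-adjacent x with adjacent (toℕ x) (toℕ w) in adj
      ... | false = ∧-zeroʳ _
      ... | true rewrite <ᵇ≡true (ℕ.≤-pred (ℕ.<-≤-trans k+1<d (subst (_≤ suc (δᶠ u x)) δ≡d (δ-adjacent (toℕ u) (toℕ x) (toℕ w) adj)))) = refl

  ball≡within : ∀ k u w → ball G u k w ≡ within k u w
  ball≡within zero u w with w Fin.≟ u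
  ... | yes refl rewrite δ-refl (toℕ w) = refl
  ... | no w≢u = by-δ (δᶠ u w) refl
    where
    by-δ : ∀ d → δᶠ u w ≡ d → false ≡ not (0 <ᵇ d)
    by-δ zero    δ≡0 = contradiction (sym (Fin.toℕ-injective (δ≡0⇒≡ (toℕ u) (toℕ w) δ≡0))) w≢u
    by-δ (suc d) _   = refl
  ball≡within (suc k) u w = trans
    (cong₂ _∨_ (ball≡within k u w) (cong or (map-cong (λ x → cong (_∧ adj G x w) (ball≡within k u x)) (allFin order))))
    (within-suc k u w)

  δ≤order : ∀ u w → δ u w ≤ order
  δ≤order u w = ℕ.≤-trans (δ≤2b u w) (ℕ.≤-trans (ℕ.+-monoʳ-≤ b (ℕ.m≤m+n b (a′ ℕ.* b))) (ℕ.n≤1+n _))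

  dist≡δ : ∀ u v → dist G u v ≡ δᶠ u v
  dist≡δ u v = begin
    dist G u v
      ≡⟨ sum-map-upTo (λ k → if ball G u k v then 0 else 1) order ⟩
    sumℕ order (λ k → if ball G u k v then 0 else 1)
      ≡⟨ sumℕ-cong order (λ k _ → cong (if_then 0 else 1) (ball≡within k u v)) ⟩
    sumℕ order (λ k → if not (k <ᵇ δᶠ u v) then 0 else 1)
      ≡⟨ sumℕ-cong order (λ k _ → if-not (k <ᵇ δᶠ u v)) ⟩
    sumℕ order (λ k → if k <ᵇ δᶠ u v then 1 else 0)
      ≡⟨ count-below order (δᶠ u v) (δ≤order (toℕ u) (toℕ v)) ⟩
    δᶠ u v ∎
    where
    open ≡-Reasoning
    if-not : ∀ t → (if not t then 0 else 1) ≡ (if t then 1 else 0)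
    if-not true  = refl
    if-not false = refl

  nearer : ℕ → ℕ → ℕ
  nearer u v = sumℕ order (λ w → if δ w u <ᵇ δ w v then 1 else 0)

  nG≡nearer : ∀ u v → nG G u v ≡ nearer (toℕ u) (toℕ v)
  nG≡nearer u v = sum-map-allFin order _ (λ w → if δ w (toℕ u) <ᵇ δ w (toℕ v) then 1 else 0)
    (λ w → cong₂ (λ p q → if p <ᵇ q then 1 else 0) (dist≡δ w u) (dist≡δ w v))

  excess : ℕ → ℕ → ℕ
  excess u v = ∣ nearer u v - nearer v u ∣

  mostar : ℕ
  mostar = sumℕ order (λ u → sumℕ order (λ v → if u <ᵇ v then excess u v else 0))

  totalMostar≡mostar : totalMostar G ≡ mostar
  totalMostar≡mostar =
    sum-map-allFin order _ (λ u → sumℕ order (λ v → if u <ᵇ v then excess u v else 0)) (λ u →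
      sum-map-allFin order _ (λ v → if toℕ u <ᵇ v then excess (toℕ u) v else 0) (λ v →
        cong (if toℕ u <ᵇ toℕ v then_else 0) (cong₂ ∣_-_∣ (nG≡nearer u v) (nG≡nearer v u))))

module Formula where

  open import Data.Integer using (_*_)

  mostarPolynomial : ℤ → ℤ → ℤ → ℤ
  mostarPolynomial a b n = (n - + 1) * (+ 3 * a * b * n - + 5 * a * b * b - + 3 * a * n + + 3 * a * b + + 2 * a
                                        + + 2 * b * b - + 9 * b + + 6 * n - + 5)

open Formula

module Counting (a′ c : ℕ) where

  open import Data.Integer using (_*_)

  open ShortestPaths a′ c

  legs : ℕ
  legs = 2 ℕ.+ a′

  onLeg : ℕ → ℕ → ℕ
  onLeg k x = suc (x ℕ.+ k ℕ.* b)

  ∑-vertices : ∀ (h : ℕ → ℤ) → ∑ order h ≡ h 0 + ∑[ k < legs ] ∑[ x < b ] h (onLeg k x)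
  ∑-vertices h = cong (_+_ (h 0)) (∑-blocks legs b (h ∘ suc))

  δ-onLeg-centre : ∀ k {x} → x < b → δ (onLeg k x) 0 ≡ suc x
  δ-onLeg-centre k x<b = cong suc ([p+kb]%b≡p k x<b)

  δ-centre-onLeg : ∀ k {x} → x < b → δ 0 (onLeg k x) ≡ suc x
  δ-centre-onLeg k x<b = cong suc ([p+kb]%b≡p k x<b)

  δ-onLeg-onLeg : ∀ k i {x p} → x < b → p < b →
    δ (onLeg k x) (onLeg i p) ≡ (if k ≡ᵇ i then ∣ x - p ∣ else suc x ℕ.+ suc p)
  δ-onLeg-onLeg k i x<b p<b
    rewrite [p+kb]/b≡k k x<b | [p+kb]%b≡p k x<b | [p+kb]/b≡k i p<b | [p+kb]%b≡p i p<b = refl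

  imbalance : ℕ → ℕ → ℤ
  imbalance u v = ∑[ w < order ] sign (δ w v) (δ w u)

  excess≡∣imbalance∣ : ∀ u v → excess u v ≡ ℤ.∣ imbalance u v ∣
  excess≡∣imbalance∣ u v = begin
    ∣ nearer u v - nearer v u ∣                             ≡⟨ ∣m-n∣≡∣m⊖n∣ (nearer u v) (nearer v u) ⟩
    ℤ.∣ nearer u v ℤ.⊖ nearer v u ∣                          ≡⟨ cong ℤ.∣_∣ (ℤ.m-n≡m⊖n (nearer u v) (nearer v u)) ⟨
    ℤ.∣ + nearer u v - + nearer v u ∣                        ≡⟨ cong ℤ.∣_∣ (cong₂ _-_ (pos-sumℕ order [_]ᵘ) (pos-sumℕ order [_]ᵛ)) ⟩
    ℤ.∣ ∑[ w < order ] + [ w ]ᵘ - ∑[ w < order ] + [ w ]ᵛ ∣ ≡⟨ cong ℤ.∣_∣ (∑-distrib-minus order (λ w → + [ w ]ᵘ) (λ w → + [ w ]ᵛ)) ⟨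
    ℤ.∣ ∑[ w < order ] (+ [ w ]ᵘ - + [ w ]ᵛ) ∣              ≡⟨ cong ℤ.∣_∣ (∑-cong order (λ w _ → cong₂ _-_ (pos-if (δ w u <ᵇ δ w v)) (pos-if (δ w v <ᵇ δ w u)))) ⟩
    ℤ.∣ imbalance u v ∣                                      ∎
    where
    open ≡-Reasoning
    [_]ᵘ [_]ᵛ : ℕ → ℕ
    [ w ]ᵘ = if δ w u <ᵇ δ w v then 1 else 0
    [ w ]ᵛ = if δ w v <ᵇ δ w u then 1 else 0
    pos-if : ∀ t → + (if t then 1 else 0) ≡ (if t then + 1 else + 0)
    pos-if true  = refl
    pos-if false = refl

  imbalance-by-legs : ∀ u v →
    imbalance u v ≡ sign (δ 0 v) (δ 0 u) + ∑[ k < legs ] ∑[ x < b ] sign (δ (onLeg k x) v) (δ (onLeg k x) u)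
  imbalance-by-legs u v = ∑-vertices (λ w → sign (δ w v) (δ w u))

  ∑-legs-select : ∀ i (x y : ℤ) → i < legs → ∑[ k < legs ] (if k ≡ᵇ i then x else y) ≡ x + (+ 1 + + a′) * y
  ∑-legs-select i x y i<legs = begin
    S                                ≡⟨ rearrange S y ⟩
    S + y - y                        ≡⟨ cong (_- y) (∑-select-const legs i x y i<legs) ⟩
    x + (+ 2 + + a′) * y - y         ≡⟨ collect x (+ a′) y ⟩
    x + (+ 1 + + a′) * y             ∎
    where
    open ≡-Reasoning
    S = ∑[ k < legs ] (if k ≡ᵇ i then x else y)
    rearrange : ∀ s y → s ≡ s + y - y
    rearrange = solve-∀
    collect : ∀ x a′ y → x + (+ 2 + a′) * y - y ≡ x + (+ 1 + a′) * y
    collect = solve-∀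

  one-special-leg : ∀ j (K : ℤ) → j < legs →
    + 1 + ∑[ k < legs ] (if k ≡ᵇ j then K else + b * + 1) ≡ K + + b + + 1 + + a′ * + b
  one-special-leg j K j<legs = begin
    + 1 + ∑[ k < legs ] (if k ≡ᵇ j then K else + b * + 1) ≡⟨ cong (_+_ (+ 1)) (∑-legs-select j K (+ b * + 1) j<legs) ⟩
    + 1 + (K + (+ 1 + + a′) * (+ b * + 1))                ≡⟨ collect K (+ a′) (+ b) ⟩
    K + + b + + 1 + + a′ * + b                            ∎
    where
    open ≡-Reasoning
    collect : ∀ K a′ b → + 1 + (K + (+ 1 + a′) * (b * + 1)) ≡ K + b + + 1 + a′ * b
    collect = solve-∀

  imbalance-centre-onLeg : ∀ j {q} → q < b → j < legs → imbalance 0 (onLeg j q) ≡ + suc q + + a′ * + b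
  imbalance-centre-onLeg j {q} q<b j<legs = begin
    imbalance 0 v
      ≡⟨ imbalance-by-legs 0 v ⟩
    sign (δ 0 v) 0 + ∑[ k < legs ] ∑[ x < b ] sign (δ (onLeg k x) v) (δ (onLeg k x) 0)
      ≡⟨ cong₂ _+_ (trans (cong (λ d → sign d 0) (δ-centre-onLeg j q<b)) (sign-> {suc q} {0} (s≤s z≤n)))
                   (∑-cong legs (λ k _ → trans (∑-cong b (λ x x<b →
                      cong₂ sign (δ-onLeg-onLeg k j x<b q<b) (δ-onLeg-centre k x<b))) (on-leg k))) ⟩
    + 1 + ∑[ k < legs ] (if k ≡ᵇ j then balance b (suc q) else + b * + 1)
      ≡⟨ one-special-leg j (balance b (suc q)) j<legs ⟩
    balance b (suc q) + + b + + 1 + + a′ * + b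
      ≡⟨ cong (_+ + a′ * + b) (balance-≤ b (suc q) (s≤s z≤n) (ℕ.≤-trans q<b (ℕ.≤-trans (ℕ.m≤m+n b b) (ℕ.n≤1+n _)))) ⟩
    + suc q + + a′ * + b ∎
    where
    open ≡-Reasoning
    v = onLeg j q
    on-leg : ∀ k → ∑[ x < b ] sign (if k ≡ᵇ j then ∣ x - q ∣ else suc x ℕ.+ suc q) (suc x)
                 ≡ (if k ≡ᵇ j then balance b (suc q) else + b * + 1)
    on-leg k with k ≡ᵇ j
    ... | true  = ∑-cong b (λ x _ → sign-∣-∣ {0} {suc q} (suc x) (s≤s z≤n))
    ... | false = trans (∑-cong b (λ x _ → sign-> (ℕ.m<m+n (suc x) {suc q} (s≤s z≤n)))) (∑-const b (+ 1))

  imbalance-same-leg : ∀ i {p q} → p < q → q < b → i < legs →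
    imbalance (onLeg i p) (onLeg i q) ≡ + (suc p ℕ.+ suc q) + + a′ * + b
  imbalance-same-leg i {p} {q} p<q q<b i<legs = begin
    imbalance u v
      ≡⟨ imbalance-by-legs u v ⟩
    sign (δ 0 v) (δ 0 u) + ∑[ k < legs ] ∑[ x < b ] sign (δ (onLeg k x) v) (δ (onLeg k x) u)
      ≡⟨ cong₂ _+_ (trans (cong₂ sign (δ-centre-onLeg i q<b) (δ-centre-onLeg i p<b)) (sign-> (s≤s p<q)))
                   (∑-cong legs (λ k _ → trans (∑-cong b (λ x x<b →
                      cong₂ sign (δ-onLeg-onLeg k i x<b q<b) (δ-onLeg-onLeg k i x<b p<b))) (on-leg k))) ⟩
    + 1 + ∑[ k < legs ] (if k ≡ᵇ i then balance b (suc p ℕ.+ suc q) else + b * + 1)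
      ≡⟨ one-special-leg i (balance b (suc p ℕ.+ suc q)) i<legs ⟩
    balance b (suc p ℕ.+ suc q) + + b + + 1 + + a′ * + b
      ≡⟨ cong (_+ + a′ * + b) (balance-≤ b (suc p ℕ.+ suc q) (s≤s z≤n) (ℕ.≤-trans (ℕ.+-mono-≤ p<b q<b) (ℕ.n≤1+n _))) ⟩
    + (suc p ℕ.+ suc q) + + a′ * + b ∎
    where
    open ≡-Reasoning
    p<b = ℕ.<-trans p<q q<b
    u = onLeg i p
    v = onLeg i q
    on-leg : ∀ k → ∑[ x < b ] sign (if k ≡ᵇ i then ∣ x - q ∣ else suc x ℕ.+ suc q)
                                    (if k ≡ᵇ i then ∣ x - p ∣ else suc x ℕ.+ suc p)
                 ≡ (if k ≡ᵇ i then balance b (suc p ℕ.+ suc q) else + b * + 1)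
    on-leg k with k ≡ᵇ i
    ... | true  = ∑-cong b (λ x _ → sign-∣-∣ (suc x) (s≤s p<q))
    ... | false = trans (∑-cong b (λ x _ → trans (sign-+ˡ (suc x) (suc q) (suc p)) (sign-> p<q))) (∑-const b (+ 1))

  p≤q⇒∣x-p∣<1+x+1+q : ∀ x {p q} → p ≤ q → ∣ x - p ∣ < suc x ℕ.+ suc q
  p≤q⇒∣x-p∣<1+x+1+q x {p} p≤q = s≤s (ℕ.≤-trans (ℕ.∣m-n∣≤m⊔n x p)
    (ℕ.≤-trans (ℕ.m⊔n≤m+n x p) (ℕ.+-monoʳ-≤ x (ℕ.≤-trans p≤q (ℕ.n≤1+n _)))))

  imbalance-other-leg : ∀ i j {p q} → p < q → q < b → i < legs → j < legs → i ≢ j →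
    imbalance (onLeg i p) (onLeg j q) ≡ + (q ∸ p) + + a′ * + b
  imbalance-other-leg i j {p} {q} p<q q<b i<legs j<legs i≢j = begin
    imbalance u v
      ≡⟨ imbalance-by-legs u v ⟩
    sign (δ 0 v) (δ 0 u) + ∑[ k < legs ] ∑[ x < b ] sign (δ (onLeg k x) v) (δ (onLeg k x) u)
      ≡⟨ cong₂ _+_ (trans (cong₂ sign (δ-centre-onLeg j q<b) (δ-centre-onLeg i p<b)) (sign-> (s≤s p<q)))
                   (∑-cong legs (λ k _ → trans (∑-cong b (λ x x<b →
                      cong₂ sign (δ-onLeg-onLeg k j x<b q<b) (δ-onLeg-onLeg k i x<b p<b))) (on-leg k))) ⟩
    + 1 + ∑[ k < legs ] (if k ≡ᵇ j then balance b (q ∸ p) else + b * + 1)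
      ≡⟨ one-special-leg j (balance b (q ∸ p)) j<legs ⟩
    balance b (q ∸ p) + + b + + 1 + + a′ * + b
      ≡⟨ cong (_+ + a′ * + b) (balance-≤ b (q ∸ p) (ℕ.m<n⇒0<n∸m p<q) q-p≤2b+1) ⟩
    + (q ∸ p) + + a′ * + b ∎
    where
    open ≡-Reasoning
    p<b = ℕ.<-trans p<q q<b
    u = onLeg i p
    v = onLeg j q
    q-p≤2b+1 : q ∸ p ≤ suc (b ℕ.+ b)
    q-p≤2b+1 = ℕ.≤-trans (ℕ.m∸n≤m q p) (ℕ.≤-trans (ℕ.<⇒≤ q<b) (ℕ.≤-trans (ℕ.m≤m+n b b) (ℕ.n≤1+n _)))
    on-leg : ∀ k → ∑[ x < b ] sign (if k ≡ᵇ j then ∣ x - q ∣ else suc x ℕ.+ suc q)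
                                    (if k ≡ᵇ i then ∣ x - p ∣ else suc x ℕ.+ suc p)
                 ≡ (if k ≡ᵇ j then balance b (q ∸ p) else + b * + 1)
    on-leg k with k ≡ᵇ i in k≡ᵇi | k ≡ᵇ j in k≡ᵇj
    ... | true  | true  = contradiction (trans (sym (≡ᵇ≡true⇒≡ {k} k≡ᵇi)) (≡ᵇ≡true⇒≡ {k} k≡ᵇj)) i≢j
    ... | true  | false = trans (∑-cong b (λ x _ → sign-> (p≤q⇒∣x-p∣<1+x+1+q x (ℕ.<⇒≤ p<q)))) (∑-const b (+ 1))
    ... | false | true  = ∑-cong b (λ x _ → sign-∣-∣-through-centre x p<q)
    ... | false | false = trans (∑-cong b (λ x _ → trans (sign-+ˡ (suc x) (suc q) (suc p)) (sign-> p<q))) (∑-const b (+ 1))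

  imbalance-level : ∀ i j {p} → p < b → i < legs → j < legs → i ≢ j → imbalance (onLeg i p) (onLeg j p) ≡ + 0
  imbalance-level i j {p} p<b i<legs j<legs i≢j = begin
    imbalance u v
      ≡⟨ imbalance-by-legs u v ⟩
    sign (δ 0 v) (δ 0 u) + ∑[ k < legs ] ∑[ x < b ] sign (δ (onLeg k x) v) (δ (onLeg k x) u)
      ≡⟨ cong₂ _+_ (trans (cong₂ sign (δ-centre-onLeg j p<b) (δ-centre-onLeg i p<b)) (sign-refl (suc p)))
                   (∑-cong legs (λ k _ → trans (∑-cong b (λ x x<b →
                      cong₂ sign (δ-onLeg-onLeg k j x<b p<b) (δ-onLeg-onLeg k i x<b p<b))) (on-leg k))) ⟩
    + 0 + S
      ≡⟨ rearrange S (+ b) ⟩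
    S + + b * + 0 + + b * + 0
      ≡⟨ ∑-select₂-const legs i j (+ b * + 1) (+ b * - + 1) (+ b * + 0) i<legs j<legs i≢j ⟩
    + b * + 1 + + b * - + 1 + + legs * (+ b * + 0)
      ≡⟨ cancel (+ a′) (+ b) ⟩
    + 0 ∎
    where
    open ≡-Reasoning
    u = onLeg i p
    v = onLeg j p
    S = ∑[ k < legs ] (if k ≡ᵇ i then + b * + 1 else if k ≡ᵇ j then + b * - + 1 else + b * + 0)
    rearrange : ∀ s b → + 0 + s ≡ s + b * + 0 + b * + 0
    rearrange = solve-∀
    cancel : ∀ a′ b → b * + 1 + b * - + 1 + (+ 2 + a′) * (b * + 0) ≡ + 0
    cancel = solve-∀
    on-leg : ∀ k → ∑[ x < b ] sign (if k ≡ᵇ j then ∣ x - p ∣ else suc x ℕ.+ suc p)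
                                    (if k ≡ᵇ i then ∣ x - p ∣ else suc x ℕ.+ suc p)
                 ≡ (if k ≡ᵇ i then + b * + 1 else if k ≡ᵇ j then + b * - + 1 else + b * + 0)
    on-leg k with k ≡ᵇ i in k≡ᵇi | k ≡ᵇ j in k≡ᵇj
    ... | true  | true  = contradiction (trans (sym (≡ᵇ≡true⇒≡ {k} k≡ᵇi)) (≡ᵇ≡true⇒≡ {k} k≡ᵇj)) i≢j
    ... | true  | false = trans (∑-cong b (λ x _ → sign-> (p≤q⇒∣x-p∣<1+x+1+q x {p} ℕ.≤-refl))) (∑-const b (+ 1))
    ... | false | true  = trans (∑-cong b (λ x _ → sign-< (p≤q⇒∣x-p∣<1+x+1+q x {p} ℕ.≤-refl))) (∑-const b (- + 1))
    ... | false | false = trans (∑-cong b (λ x _ → trans (sign-+ˡ (suc x) (suc p) (suc p)) (sign-refl p))) (∑-const b (+ 0))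

  excess-comm : ∀ u v → excess u v ≡ excess v u
  excess-comm u v = ℕ.∣-∣-comm (nearer u v) (nearer v u)

  excess-diag : ∀ u → excess u u ≡ 0
  excess-diag u = ℕ.∣n-n∣≡0 (nearer u u)

  excess-from-imbalance : ∀ u v m → imbalance u v ≡ + m + + a′ * + b → + excess u v ≡ + m + + a′ * + b
  excess-from-imbalance u v m eq = begin
    + excess u v            ≡⟨ cong +_ (excess≡∣imbalance∣ u v) ⟩
    + ℤ.∣ imbalance u v ∣   ≡⟨ cong (λ z → + ℤ.∣ z ∣) (trans eq (cong (_+_ (+ m)) (sym (ℤ.pos-* a′ b)))) ⟩
    + m + + (a′ ℕ.* b)      ≡⟨ cong (_+_ (+ m)) (ℤ.pos-* a′ b) ⟩
    + m + + a′ * + b        ∎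
    where open ≡-Reasoning

  pairSame : ℕ → ℕ → ℤ
  pairSame p q = if q ≡ᵇ p then + 0 else + (suc p ℕ.+ suc q) + + a′ * + b

  pairOther : ℕ → ℕ → ℤ
  pairOther p q = (if q ≡ᵇ p then + 0 else + a′ * + b) + + ∣ p - q ∣

  excess-onLeg-onLeg : ∀ i j {p q} → p < b → q < b → i < legs → j < legs →
    + excess (onLeg i p) (onLeg j q) ≡ (if j ≡ᵇ i then pairSame p q else pairOther p q)
  excess-onLeg-onLeg i j {p} {q} p<b q<b i<legs j<legs with j ≡ᵇ i in j≡ᵇi | ℕ.<-cmp p q
  ... | true | tri< p<q _ _ rewrite ≡ᵇ≡true⇒≡ {j} j≡ᵇi | ≢⇒≡ᵇ≡false (ℕ.>⇒≢ p<q) =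
    excess-from-imbalance (onLeg i p) (onLeg i q) (suc p ℕ.+ suc q) (imbalance-same-leg i p<q q<b i<legs)
  ... | true | tri≈ _ refl _ rewrite ≡ᵇ≡true⇒≡ {j} j≡ᵇi | ≡⇒≡ᵇ≡true {p} refl =
    cong +_ (excess-diag (onLeg i p))
  ... | true | tri> _ _ q<p rewrite ≡ᵇ≡true⇒≡ {j} j≡ᵇi | ≢⇒≡ᵇ≡false (ℕ.<⇒≢ q<p) = begin
    + excess (onLeg i p) (onLeg i q)             ≡⟨ cong +_ (excess-comm (onLeg i p) (onLeg i q)) ⟩
    + excess (onLeg i q) (onLeg i p)             ≡⟨ excess-from-imbalance (onLeg i q) (onLeg i p) (suc q ℕ.+ suc p) (imbalance-same-leg i q<p p<b i<legs) ⟩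
    + (suc q ℕ.+ suc p) + + a′ * + b             ≡⟨ cong (λ n → + n + + a′ * + b) (ℕ.+-comm (suc q) (suc p)) ⟩
    + (suc p ℕ.+ suc q) + + a′ * + b             ∎
    where open ≡-Reasoning
  ... | false | tri< p<q _ _ rewrite ≢⇒≡ᵇ≡false (ℕ.>⇒≢ p<q) | ℕ.m≤n⇒∣m-n∣≡n∸m (ℕ.<⇒≤ p<q) =
    trans (excess-from-imbalance (onLeg i p) (onLeg j q) (q ∸ p) (imbalance-other-leg i j p<q q<b i<legs j<legs i≢j)) (ℤ.+-comm (+ (q ∸ p)) (+ a′ * + b))
    where
    i≢j : i ≢ j
    i≢j i≡j = ≡ᵇ≡false⇒≢ j≡ᵇi (sym i≡j)
  ... | false | tri≈ _ refl _ rewrite ≡⇒≡ᵇ≡true {p} refl | ℕ.∣n-n∣≡0 p =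
    cong +_ (trans (excess≡∣imbalance∣ (onLeg i p) (onLeg j p)) (cong ℤ.∣_∣ (imbalance-level i j p<b i<legs j<legs i≢j)))
    where
    i≢j : i ≢ j
    i≢j i≡j = ≡ᵇ≡false⇒≢ j≡ᵇi (sym i≡j)
  ... | false | tri> _ _ q<p rewrite ≢⇒≡ᵇ≡false (ℕ.<⇒≢ q<p) | ℕ.m≤n⇒∣n-m∣≡n∸m (ℕ.<⇒≤ q<p) = begin
    + excess (onLeg i p) (onLeg j q) ≡⟨ cong +_ (excess-comm (onLeg i p) (onLeg j q)) ⟩
    + excess (onLeg j q) (onLeg i p) ≡⟨ excess-from-imbalance (onLeg j q) (onLeg i p) (p ∸ q) (imbalance-other-leg j i q<p p<b j<legs i<legs (≡ᵇ≡false⇒≢ j≡ᵇi)) ⟩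
    + (p ∸ q) + + a′ * + b           ≡⟨ ℤ.+-comm (+ (p ∸ q)) (+ a′ * + b) ⟩
    + a′ * + b + + (p ∸ q)           ∎
    where open ≡-Reasoning

  centreRow : ℤ
  centreRow = ∑[ q < b ] (+ suc q + + a′ * + b)

  row-centre : ∑[ v < order ] + excess 0 v ≡ + legs * centreRow
  row-centre = begin
    ∑[ v < order ] + excess 0 v
      ≡⟨ ∑-vertices (λ v → + excess 0 v) ⟩
    + excess 0 0 + ∑[ j < legs ] ∑[ q < b ] + excess 0 (onLeg j q)
      ≡⟨ cong₂ _+_ (cong +_ (excess-diag 0)) (∑-cong legs (λ j j<legs → ∑-cong b (λ q q<b →
           excess-from-imbalance 0 (onLeg j q) (suc q) (imbalance-centre-onLeg j q<b j<legs)))) ⟩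
    + 0 + ∑[ j < legs ] centreRow
      ≡⟨ trans (ℤ.+-identityˡ _) (∑-const legs centreRow) ⟩
    + legs * centreRow ∎
    where open ≡-Reasoning

  legRow : ℕ → ℤ
  legRow p = + suc p + + a′ * + b + (∑[ q < b ] pairSame p q + (+ 1 + + a′) * ∑[ q < b ] pairOther p q)

  row-onLeg : ∀ i p → i < legs → p < b → ∑[ v < order ] + excess (onLeg i p) v ≡ legRow p
  row-onLeg i p i<legs p<b = begin
    ∑[ v < order ] + excess u v
      ≡⟨ ∑-vertices (λ v → + excess u v) ⟩
    + excess u 0 + ∑[ j < legs ] ∑[ q < b ] + excess u (onLeg j q)
      ≡⟨ cong₂ _+_ to-centre (∑-cong legs (λ j j<legs → trans
           (∑-cong b (λ q q<b → excess-onLeg-onLeg i j p<b q<b i<legs j<legs)) (by-leg j))) ⟩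
    + suc p + + a′ * + b + ∑[ j < legs ] (if j ≡ᵇ i then ∑ b (pairSame p) else ∑ b (pairOther p))
      ≡⟨ cong (_+_ (+ suc p + + a′ * + b)) (∑-legs-select i (∑ b (pairSame p)) (∑ b (pairOther p)) i<legs) ⟩
    legRow p ∎
    where
    open ≡-Reasoning
    u = onLeg i p
    to-centre : + excess u 0 ≡ + suc p + + a′ * + b
    to-centre = trans (cong +_ (excess-comm u 0)) (excess-from-imbalance 0 u (suc p) (imbalance-centre-onLeg i p<b i<legs))
    by-leg : ∀ j → ∑[ q < b ] (if j ≡ᵇ i then pairSame p q else pairOther p q)
                   ≡ (if j ≡ᵇ i then ∑ b (pairSame p) else ∑ b (pairOther p))
    by-leg j with j ≡ᵇ i
    ... | true  = refl
    ... | false = refl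

  2*mostar : + 2 * + mostar ≡ + legs * centreRow + + legs * ∑[ p < b ] legRow p
  2*mostar = begin
    + 2 * + mostar
      ≡⟨ ∑∑-upper order excess excess-comm excess-diag ⟩
    ∑[ u < order ] ∑[ v < order ] + excess u v
      ≡⟨ ∑-vertices (λ u → ∑[ v < order ] + excess u v) ⟩
    ∑[ v < order ] + excess 0 v + ∑[ i < legs ] ∑[ p < b ] ∑[ v < order ] + excess (onLeg i p) v
      ≡⟨ cong₂ _+_ row-centre (∑-cong legs (λ i i<legs → ∑-cong b (λ p p<b → row-onLeg i p i<legs p<b))) ⟩
    + legs * centreRow + ∑[ i < legs ] ∑[ p < b ] legRow p
      ≡⟨ cong (_+_ (+ legs * centreRow)) (∑-const legs (∑[ p < b ] legRow p)) ⟩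
    + legs * centreRow + + legs * ∑[ p < b ] legRow p ∎
    where open ≡-Reasoning

  a′b S₁ S₂ : ℤ
  a′b = + a′ * + b
  S₁ = ∑[ q < b ] + q
  S₂ = ∑[ p < b ] ∑[ q < b ] + ∣ p - q ∣

  centreRow≡ : centreRow ≡ + b * (+ 1 + a′b) + S₁
  centreRow≡ = begin
    ∑[ q < b ] (+ suc q + a′b)           ≡⟨ ∑-cong b (λ q _ → linear (+ q) a′b) ⟩
    ∑[ q < b ] (+ 1 + a′b + + 1 * + q)   ≡⟨ ∑-linear b (+ 1 + a′b) (+ 1) ⟩
    + b * (+ 1 + a′b) + + 1 * S₁          ≡⟨ cong (_+_ (+ b * (+ 1 + a′b))) (ℤ.*-identityˡ S₁) ⟩
    + b * (+ 1 + a′b) + S₁                ∎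
    where
    open ≡-Reasoning
    linear : ∀ q x → + 1 + q + x ≡ + 1 + x + + 1 * q
    linear = solve-∀

  ∑-pairSame : ∀ p → p < b → ∑ b (pairSame p) ≡ + b * (+ 2 + + p + a′b) + S₁ - (+ 2 + + p + + p + a′b)
  ∑-pairSame p p<b = begin
    ∑ b (pairSame p)                                   ≡⟨ rearrange (∑ b (pairSame p)) (g p) ⟩
    ∑ b (pairSame p) + g p - g p                       ≡⟨ cong (_- g p) (∑-select b p (λ _ → + 0) g p<b) ⟩
    + 0 + ∑ b g - g p                                  ≡⟨ cong (λ t → + 0 + t - g p) (∑-cong b (λ q _ → linear (+ p) (+ q) a′b)) ⟩
    + 0 + ∑[ q < b ] (+ 2 + + p + a′b + + 1 * + q) - g p ≡⟨ cong (λ t → + 0 + t - g p) (∑-linear b (+ 2 + + p + a′b) (+ 1)) ⟩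
    + 0 + (+ b * (+ 2 + + p + a′b) + + 1 * S₁) - g p   ≡⟨ tidy (+ b * (+ 2 + + p + a′b)) S₁ (+ p) a′b ⟩
    + b * (+ 2 + + p + a′b) + S₁ - (+ 2 + + p + + p + a′b) ∎
    where
    open ≡-Reasoning
    g : ℕ → ℤ
    g q = + (suc p ℕ.+ suc q) + a′b
    rearrange : ∀ s t → s ≡ s + t - t
    rearrange = solve-∀
    linear : ∀ p q x → + 1 + p + (+ 1 + q) + x ≡ + 2 + p + x + + 1 * q
    linear = solve-∀
    tidy : ∀ y s p x → + 0 + (y + + 1 * s) - (+ 1 + p + (+ 1 + p) + x) ≡ y + s - (+ 2 + p + p + x)
    tidy = solve-∀

  ∑-pairOther : ∀ p → p < b → ∑ b (pairOther p) ≡ + b * a′b - a′b + ∑[ q < b ] + ∣ p - q ∣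
  ∑-pairOther p p<b = begin
    ∑ b (pairOther p)
      ≡⟨ ∑-distrib-+ b (λ q → if q ≡ᵇ p then + 0 else a′b) (λ q → + ∣ p - q ∣) ⟩
    ∑[ q < b ] (if q ≡ᵇ p then + 0 else a′b) + D
      ≡⟨ cong (_+ D) (rearrange (∑[ q < b ] (if q ≡ᵇ p then + 0 else a′b)) a′b) ⟩
    ∑[ q < b ] (if q ≡ᵇ p then + 0 else a′b) + a′b - a′b + D
      ≡⟨ cong (λ t → t - a′b + D) (trans (∑-select-const b p (+ 0) a′b p<b) (ℤ.+-identityˡ (+ b * a′b))) ⟩
    + b * a′b - a′b + D ∎
    where
    open ≡-Reasoning
    D = ∑[ q < b ] + ∣ p - q ∣
    rearrange : ∀ s t → s ≡ s + t - t
    rearrange = solve-∀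

  ∑∑-pairSame : ∑[ p < b ] ∑ b (pairSame p) ≡ + b * (+ b * (+ 2 + a′b) + S₁ - (+ 2 + a′b)) + (+ b - + 2) * S₁
  ∑∑-pairSame = begin
    ∑[ p < b ] ∑ b (pairSame p)
      ≡⟨ ∑-cong b (λ p p<b → trans (∑-pairSame p p<b) (linear (+ b) (+ p) a′b S₁)) ⟩
    ∑[ p < b ] (+ b * (+ 2 + a′b) + S₁ - (+ 2 + a′b) + (+ b - + 2) * + p)
      ≡⟨ ∑-linear b (+ b * (+ 2 + a′b) + S₁ - (+ 2 + a′b)) (+ b - + 2) ⟩
    + b * (+ b * (+ 2 + a′b) + S₁ - (+ 2 + a′b)) + (+ b - + 2) * S₁ ∎
    where
    open ≡-Reasoning
    linear : ∀ b p x s → b * (+ 2 + p + x) + s - (+ 2 + p + p + x) ≡ b * (+ 2 + x) + s - (+ 2 + x) + (b - + 2) * p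
    linear = solve-∀

  ∑∑-pairOther : ∑[ p < b ] ∑ b (pairOther p) ≡ + b * (+ b * a′b - a′b) + S₂
  ∑∑-pairOther = begin
    ∑[ p < b ] ∑ b (pairOther p)
      ≡⟨ ∑-cong b (λ p p<b → ∑-pairOther p p<b) ⟩
    ∑[ p < b ] (+ b * a′b - a′b + ∑[ q < b ] + ∣ p - q ∣)
      ≡⟨ ∑-distrib-+ b (λ _ → + b * a′b - a′b) (λ p → ∑[ q < b ] + ∣ p - q ∣) ⟩
    ∑[ p < b ] (+ b * a′b - a′b) + S₂
      ≡⟨ cong (_+ S₂) (∑-const b (+ b * a′b - a′b)) ⟩
    + b * (+ b * a′b - a′b) + S₂ ∎
    where open ≡-Reasoning

  ∑-legRow : ∑[ p < b ] legRow p ≡ centreRow + ∑[ p < b ] ∑ b (pairSame p) + (+ 1 + + a′) * ∑[ p < b ] ∑ b (pairOther p)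
  ∑-legRow = begin
    ∑[ p < b ] legRow p
      ≡⟨ ∑-distrib-+ b (λ p → + suc p + a′b) (λ p → ∑ b (pairSame p) + (+ 1 + + a′) * ∑ b (pairOther p)) ⟩
    centreRow + ∑[ p < b ] (∑ b (pairSame p) + (+ 1 + + a′) * ∑ b (pairOther p))
      ≡⟨ cong (_+_ centreRow) (∑-distrib-+ b (λ p → ∑ b (pairSame p)) (λ p → (+ 1 + + a′) * ∑ b (pairOther p))) ⟩
    centreRow + (∑[ p < b ] ∑ b (pairSame p) + ∑[ p < b ] ((+ 1 + + a′) * ∑ b (pairOther p)))
      ≡⟨ cong (λ t → centreRow + (∑[ p < b ] ∑ b (pairSame p) + t)) (∑-*ˡ b (+ 1 + + a′) (λ p → ∑ b (pairOther p))) ⟩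
    centreRow + (∑[ p < b ] ∑ b (pairSame p) + (+ 1 + + a′) * ∑[ p < b ] ∑ b (pairOther p))
      ≡⟨ ℤ.+-assoc centreRow _ _ ⟨
    centreRow + ∑[ p < b ] ∑ b (pairSame p) + (+ 1 + + a′) * ∑[ p < b ] ∑ b (pairOther p) ∎
    where open ≡-Reasoning

  -- The power sums s₁ = ∑ q and s₂ = ∑ ∣p - q∣ enter linearly, with coefficients divisible by 2 and 3.
  eliminate-power-sums : ∀ a′ b s₁ s₂ → + 2 * s₁ ≡ b * b - b → + 3 * s₂ ≡ b * b * b - b →
    + 3 * ((+ 2 + a′) * (b * (+ 1 + a′ * b) + s₁)
           + (+ 2 + a′) * (b * (+ 1 + a′ * b) + s₁
                           + (b * (b * (+ 2 + a′ * b) + s₁ - (+ 2 + a′ * b)) + (b - + 2) * s₁)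
                           + (+ 1 + a′) * (b * (b * (a′ * b) - a′ * b) + s₂)))
    ≡ mostarPolynomial (+ 2 + a′) b (+ 1 + (+ 2 + a′) * b)
  eliminate-power-sums a′ b s₁ s₂ 2s₁ 3s₂ = begin
    _ ≡⟨ separate a′ b s₁ s₂ ⟩
    F + (+ 3 * (+ 2 + a′) * b) * (+ 2 * s₁) + ((+ 2 + a′) * (+ 1 + a′)) * (+ 3 * s₂)
      ≡⟨ cong₂ (λ x y → F + (+ 3 * (+ 2 + a′) * b) * x + ((+ 2 + a′) * (+ 1 + a′)) * y) 2s₁ 3s₂ ⟩
    F + (+ 3 * (+ 2 + a′) * b) * (b * b - b) + ((+ 2 + a′) * (+ 1 + a′)) * (b * b * b - b)
      ≡⟨ collect a′ b ⟩
    mostarPolynomial (+ 2 + a′) b (+ 1 + (+ 2 + a′) * b) ∎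
    where
    open ≡-Reasoning
    F = + 3 * ((+ 2 + a′) * (b * (+ 1 + a′ * b))
               + (+ 2 + a′) * (b * (+ 1 + a′ * b) + b * (b * (+ 2 + a′ * b) - (+ 2 + a′ * b))
                               + (+ 1 + a′) * (b * (b * (a′ * b) - a′ * b))))
    separate : ∀ a′ b s₁ s₂ →
      + 3 * ((+ 2 + a′) * (b * (+ 1 + a′ * b) + s₁)
             + (+ 2 + a′) * (b * (+ 1 + a′ * b) + s₁
                             + (b * (b * (+ 2 + a′ * b) + s₁ - (+ 2 + a′ * b)) + (b - + 2) * s₁)
                             + (+ 1 + a′) * (b * (b * (a′ * b) - a′ * b) + s₂)))
      ≡ + 3 * ((+ 2 + a′) * (b * (+ 1 + a′ * b))
               + (+ 2 + a′) * (b * (+ 1 + a′ * b) + b * (b * (+ 2 + a′ * b) - (+ 2 + a′ * b))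
                               + (+ 1 + a′) * (b * (b * (a′ * b) - a′ * b))))
        + (+ 3 * (+ 2 + a′) * b) * (+ 2 * s₁) + ((+ 2 + a′) * (+ 1 + a′)) * (+ 3 * s₂)
    separate = solve-∀
    collect : ∀ a′ b →
      + 3 * ((+ 2 + a′) * (b * (+ 1 + a′ * b))
             + (+ 2 + a′) * (b * (+ 1 + a′ * b) + b * (b * (+ 2 + a′ * b) - (+ 2 + a′ * b))
                             + (+ 1 + a′) * (b * (b * (a′ * b) - a′ * b))))
        + (+ 3 * (+ 2 + a′) * b) * (b * b - b) + ((+ 2 + a′) * (+ 1 + a′)) * (b * b * b - b)
      ≡ ((+ 1 + (+ 2 + a′) * b) - + 1)
          * (+ 3 * (+ 2 + a′) * b * (+ 1 + (+ 2 + a′) * b) - + 5 * (+ 2 + a′) * b * b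
             - + 3 * (+ 2 + a′) * (+ 1 + (+ 2 + a′) * b) + + 3 * (+ 2 + a′) * b + + 2 * (+ 2 + a′)
             + + 2 * b * b - + 9 * b + + 6 * (+ 1 + (+ 2 + a′) * b) - + 5)
    collect = solve-∀

  6*mostar : + 6 * + mostar ≡ mostarPolynomial (+ legs) (+ b) (+ 1 + + legs * + b)
  6*mostar = begin
    + 6 * + mostar
      ≡⟨ triple (+ mostar) ⟩
    + 3 * (+ 2 * + mostar)
      ≡⟨ cong (+ 3 *_) (trans 2*mostar (cong (λ t → + legs * centreRow + + legs * t) ∑-legRow)) ⟩
    + 3 * (+ legs * centreRow + + legs * (centreRow + ∑[ p < b ] ∑ b (pairSame p) + (+ 1 + + a′) * ∑[ p < b ] ∑ b (pairOther p)))
      ≡⟨ cong₃ (λ x y z → + 3 * (+ legs * x + + legs * (x + y + (+ 1 + + a′) * z))) centreRow≡ ∑∑-pairSame ∑∑-pairOther ⟩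
    _ ≡⟨ eliminate-power-sums (+ a′) (+ b) S₁ S₂ (2∑i b) (3∑∑∣i-j∣ b) ⟩
    mostarPolynomial (+ legs) (+ b) (+ 1 + + legs * + b) ∎
    where
    open ≡-Reasoning
    triple : ∀ m → + 6 * m ≡ + 3 * (+ 2 * m)
    triple = solve-∀
    cong₃ : ∀ (f : ℤ → ℤ → ℤ → ℤ) {x x′ y y′ z z′} → x ≡ x′ → y ≡ y′ → z ≡ z′ → f x y z ≡ f x′ y′ z′
    cong₃ f refl refl refl = refl

open import Data.Nat using (_*_)
import Data.Integer

pos-*-* : ∀ x y z → + (x * y * z) ≡ + x ℤ.* + y ℤ.* + z
pos-*-* x y z = trans (ℤ.pos-* (x * y) z) (cong (ℤ._* + z) (ℤ.pos-* x y))

pos-*-*-* : ∀ w x y z → + (w * x * y * z) ≡ + w ℤ.* + x ℤ.* + y ℤ.* + z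
pos-*-*-* w x y z = trans (ℤ.pos-* (w * x * y) z) (cong (ℤ._* + z) (pos-*-* w x y))

mostarPolynomial-pos : ∀ a b n →
  Data.Integer._*_ (+ n - + 1)
    (+ (3 * a * b * n) - + (5 * a * b * b) - + (3 * a * n) + + (3 * a * b) + + (2 * a)
      + + (2 * b * b) - + (9 * b) + + (6 * n) - + 5)
  ≡ mostarPolynomial (+ a) (+ b) (+ n)
mostarPolynomial-pos a b n
  rewrite pos-*-*-* 3 a b n | pos-*-*-* 5 a b b | pos-*-* 3 a n | pos-*-* 3 a b
        | ℤ.pos-* 2 a | pos-*-* 2 b b | ℤ.pos-* 9 b | ℤ.pos-* 6 n = refl

mainTheorem12 : (a b n : ℕ) → 2 ≤ a → 1 ≤ b → n ≡ suc (a * b) →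
    Data.Integer._*_ (+ 6) (+ totalMostar (spider a b))
    ≡ Data.Integer._*_ (+ n - + 1)
    (+ (3 * a * b * n) - + (5 * a * b * b) - + (3 * a * n) + + (3 * a * b) + + (2 * a)
    + + (2 * b * b) - + (9 * b) + + (6 * n) - + 5)
mainTheorem12 a@(suc (suc a′)) b@(suc c) n (s≤s (s≤s z≤n)) (s≤s z≤n) refl = begin
  + 6 ℤ.* + totalMostar (spider a b)
    ≡⟨ cong (λ m → + 6 ℤ.* + m) (ShortestPaths.totalMostar≡mostar a′ c) ⟩
  + 6 ℤ.* + ShortestPaths.mostar a′ c
    ≡⟨ Counting.6*mostar a′ c ⟩
  mostarPolynomial (+ a) (+ b) (+ 1 + + a ℤ.* + b)
    ≡⟨ cong (λ m → mostarPolynomial (+ a) (+ b) (+ 1 + m)) (ℤ.pos-* a b) ⟨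
  mostarPolynomial (+ a) (+ b) (+ n)
    ≡⟨ mostarPolynomial-pos a b n ⟨
  _ ∎
  where
  open ≡-Reasoning
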